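{- Let $F$ be a color-critical graph on $f$ vertices with $\chi(F)=r+1$. There exists a constant $\gamma_F>0$ such that the following holds for all sufficiently large $n$. Let $\alpha_1,\alpha_2$ be nonnegative integers and let $G$ be a graph obtained from an $n$-vertex complete $r$-partite graph $K_r(n_1,\dots,n_r)$, $n_1\ge\cdots\ge n_r$, by adding $\alpha_1$ class-edges and deleting $\alpha_2$ cross-edges. Set $\phi=\max\{2(\alpha_1+\alpha_2),\,n_1-n_r\}$. Then \[\alpha_1c(n,F)-\gamma_F\alpha_1\phi n^{f-3}\le N_F(G)\le \alpha_1c(n,F)+\gamma_F\alpha_1\phi n^{f-3}.\]
   Context: A graph is color-critical if it contains an edge whose deletion reduces its chromatic number. $T_{n,r}$ is the $n$-vertex complete $r$-partite graph with part sizes as equal as possible. $N_F(G)$ is the number of copies of $F$ in $G$ (subgraphs isomorphic to $F$); $c(n,F)$ is the minimum of $N_F(H)$ over graphs $H$ obtained from $T_{n,r}$ by adding one edge. For the complete $r$-partite graph with parts $V_1,\dots,V_r$, a class-edge is an edge inside a part and a cross-edge is an edge between distinct parts. -}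

module Defs where

open import Data.Nat using (ℕ; zero; suc; _+_; _*_; _∸_; _^_; _≤_; _<_; _⊔_; _⊓_)
open import Data.Bool using (Bool; true; false; _∧_; _∨_; not)
open import Data.Bool.Properties using () renaming (_≟_ to _≟B_)
open import Data.Fin using (Fin) renaming (_≟_ to _≟F_; _<?_ to _<?F_)
open import Data.Bool.ListAction using (all; any)
open import Data.List using (List; []; _∷_; map; concatMap; length; filterᵇ; allFin; cartesianProduct; foldr; deduplicate)
open import Data.Vec using (Vec; lookup; tabulate) renaming ([] to []ᵥ; _∷_ to _∷ᵥ_)
import Data.Vec.Properties as VecP
import Data.Product.Properties as ProdP
open import Data.Product using (Σ; _×_; _,_)
open import Relation.Nullary using (¬_)
open import Relation.Nullary.Decidable using (⌊_⌋)
open import Relation.Binary.PropositionalEquality using (_≡_; _≢_)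

record Graph (n : ℕ) : Set where
  field
    adj     : Fin n → Fin n → Bool
    adj-sym : ∀ u v → adj u v ≡ adj v u
    adj-irr : ∀ u → adj u u ≡ false
open Graph public

Adj : ℕ → Set
Adj n = Fin n → Fin n → Bool

eqF : ∀ {n} → Fin n → Fin n → Bool
eqF i j = ⌊ i ≟F j ⌋

ltF : ∀ {n} → Fin n → Fin n → Bool
ltF i j = ⌊ i <?F j ⌋

isPair : ∀ {n} → Fin n → Fin n → Fin n → Fin n → Bool
isPair a b u v = (eqF u a ∧ eqF v b) ∨ (eqF u b ∧ eqF v a)

deleteEdge : ∀ {n} → Adj n → Fin n → Fin n → Adj n
deleteEdge A a b u v = A u v ∧ not (isPair a b u v)

addEdge : ∀ {n} → Adj n → Fin n → Fin n → Adj n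
addEdge A a b u v = A u v ∨ isPair a b u v

Colorable : ∀ {n} → Adj n → ℕ → Set
Colorable {n} A k = Σ (Fin n → Fin k) λ c → ∀ u v → A u v ≡ true → c u ≢ c v

ChromaticNumber : ∀ {n} → Adj n → ℕ → Set
ChromaticNumber A k = Colorable A k × (∀ j → j < k → ¬ Colorable A j)

ColorCritical : ∀ {f} → Graph f → Set
ColorCritical {f} F =
  Σ (Fin f) λ a → Σ (Fin f) λ b → adj F a b ≡ true ×
    (∀ k → ChromaticNumber (adj F) k →
       Σ ℕ λ j → j < k × ChromaticNumber (deleteEdge (adj F) a b) j)

allVecs : (f n : ℕ) → List (Vec (Fin n) f)
allVecs zero    n = []ᵥ ∷ []
allVecs (suc f) n = concatMap (λ i → map (i ∷ᵥ_) (allVecs f n)) (allFin n)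

pairs : (n : ℕ) → List (Fin n × Fin n)
pairs n = cartesianProduct (allFin n) (allFin n)

isEmbedding : ∀ {f n} → Adj f → Adj n → Vec (Fin n) f → Bool
isEmbedding {f} AF AG φ =
  all (λ { (i , j) → not (eqF (lookup φ i) (lookup φ j)) ∨ eqF i j }) (pairs f) ∧
  all (λ { (i , j) → not (AF i j) ∨ AG (lookup φ i) (lookup φ j) }) (pairs f)

-- the subgraph φ(F) of G: (vertex set, edge set)
SubgraphRep : ℕ → Set
SubgraphRep n = Vec Bool n × Vec (Vec Bool n) n

image : ∀ {f n} → Adj f → Vec (Fin n) f → SubgraphRep n
image {f} AF φ =
  tabulate (λ w → any (λ i → eqF (lookup φ i) w) (allFin f)) ,
  tabulate (λ x → tabulate (λ y →
    any (λ { (i , j) → AF i j ∧ eqF (lookup φ i) x ∧ eqF (lookup φ j) y }) (pairs f)))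

≟Rep : ∀ {n} (x y : SubgraphRep n) → Relation.Nullary.Dec (x ≡ y)
≟Rep = ProdP.≡-dec (VecP.≡-dec _≟B_) (VecP.≡-dec (VecP.≡-dec _≟B_))

copies : ∀ {f n} → Graph f → Adj n → ℕ
copies {f} {n} F AG =
  length (deduplicate ≟Rep (map (image (adj F)) (filterᵇ (isEmbedding (adj F) AG) (allVecs f n))))

completePartite : ∀ {n r} → (Fin n → Fin r) → Adj n
completePartite p u v = not (eqF (p u) (p v))

partSize : ∀ {n r} → (Fin n → Fin r) → Fin r → ℕ
partSize {n} p i = length (filterᵇ (λ v → eqF (p v) i) (allFin n))

Balanced : ∀ {n r} → (Fin n → Fin r) → Set
Balanced p = ∀ i j → partSize p i ≤ partSize p j + 1

spread : ∀ {n r} → (Fin n → Fin r) → ℕ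
spread {n} {r} p =
  foldr _⊔_ 0 (map (partSize p) (allFin r)) ∸ foldr _⊓_ n (map (partSize p) (allFin r))

-- number of class-edges of G (edges inside a part), i.e. added class-edges
classEdgesAdded : ∀ {n r} → (Fin n → Fin r) → Graph n → ℕ
classEdgesAdded {n} p G =
  length (filterᵇ (λ { (u , v) → ltF u v ∧ eqF (p u) (p v) ∧ adj G u v }) (pairs n))

-- number of cross pairs that are not edges of G, i.e. deleted cross-edges
crossEdgesDeleted : ∀ {n r} → (Fin n → Fin r) → Graph n → ℕ
crossEdgesDeleted {n} p G =
  length (filterᵇ (λ { (u , v) → ltF u v ∧ not (eqF (p u) (p v)) ∧ not (adj G u v) }) (pairs n))

TuranPlusEdgeValue : ∀ {f} → Graph f → (n r : ℕ) → ℕ → Set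
TuranPlusEdgeValue F n r c =
  Σ (Fin n → Fin r) λ p → Balanced p ×
    Σ (Fin n) λ a → Σ (Fin n) λ b → a ≢ b × p a ≡ p b ×
      copies F (addEdge (completePartite p) a b) ≡ c

IsCnF : ∀ {f} → Graph f → (n r : ℕ) → ℕ → Set
IsCnF F n r c = TuranPlusEdgeValue F n r c × (∀ c' → TuranPlusEdgeValue F n r c' → c ≤ c')

module Submission where

-- Count embeddings instead of copies: #Emb F H = copies F H · #Aut F with #Aut F ≥ 1, so it suffices
-- to estimate #Emb F G.  As F is not r-colourable, every embedding of F into G maps an edge of F
-- onto a class-edge of G.  An embedding into G that uses exactly one class-edge e and no deleted
-- cross-edge is the same thing as an embedding into K_p + e; every other embedding on either side
-- covers a class-edge together with a vertex of a second class-edge or of a deleted cross-edge, and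
-- for each such pair there are at most f³ n^(f-3) embeddings through three prescribed vertices.
-- Hence #Emb F G differs from Σ_e #Emb F (K_p + e) by at most α₁ (α₁ + α₂) f³ n^(f-3).  Each
-- #Emb F (K_p + e) is compared with c(n,F) · #Aut F = #Emb F (T_{n,r} + e*): after relabelling
-- vertices and parts, p is turned into a Turán partition by swapping and moving single vertices,
-- each move changes the count by at most f³ n^(f-3), and at most r (n₁ - n_r + 1) moves are needed.
-- All estimates are multiplied by n³ so that the truncated power n^(f-3) never occurs.

open import Defs
open import Data.Nat using (ℕ; zero; suc; _+_; _*_; _^_; _≤_; _<_; _⊔_; _⊓_; z≤n; s≤s; ∣_-_∣)
open import Data.Nat.Properties
open import Data.Nat.ListAction using (sum)
open import Data.Bool using (Bool; true; false; _∧_; _∨_; not; T)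
import Data.Bool.Properties as Boolₚ
open Boolₚ using (T-≡)
open import Data.Fin using (Fin; zero; suc) renaming (_≟_ to _≟ᶠ_; _<_ to _<ᶠ_; _<?_ to _<?ᶠ_)
import Data.Fin.Properties as Finₚ
open import Data.Vec using (Vec; []; _∷_; lookup; tabulate)
import Data.Vec
import Data.Vec.Properties as Vecₚ
open import Data.Vec.Functional using (updateAt)
open import Data.Vec.Functional.Properties using (updateAt-updates; updateAt-minimal)
open import Data.List using (List; []; _∷_; _++_; map; concatMap; length; filterᵇ; allFin; foldr; deduplicate)
open import Data.List.Membership.Propositional using (_∈_; find; lose)
open import Data.List.Relation.Unary.All.Properties using (all⁺; all⁻)
open import Data.List.Relation.Unary.Any.Properties using (any⁺; any⁻)
open import Data.List.Membership.Propositional.Properties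
  using (∈-allFin; ∈-cartesianProduct⁺; ∈-map⁺; ∈-map⁻; ∈-deduplicate⁺; ∈-deduplicate⁻; ∈-filter⁺; ∈-filter⁻)
open import Data.List.Relation.Unary.Unique.DecPropositional.Properties using (deduplicate-!)
open import Data.List.Relation.Unary.Any using (here; there)
import Data.List.Relation.Unary.All as All
open import Data.List.Relation.Unary.AllPairs using ([]; _∷_)
open import Data.List.Relation.Unary.Unique.Propositional using (Unique)
import Data.List.Relation.Unary.Unique.Propositional.Properties as Uniqueₚ
import Data.List.Properties as Listₚ
open Listₚ using (filter-≐)
open import Data.Product using (Σ; ∃-syntax; _×_; _,_; proj₁; proj₂)
import Data.Product.Properties as Prodₚ
open import Data.Sum using (_⊎_; inj₁; inj₂; [_,_])
open import Function using (id; _∘_; _⟨_⟩_; _⇔_; mk⇔; Equivalence)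
open import Relation.Nullary using (¬_; yes; no; Dec; contradiction; _×-dec_; ¬?)
open import Induction.WellFounded using (Acc; acc)
open import Data.Nat.Induction using (<-wellFounded)
open import Relation.Nullary.Decidable using (⌊_⌋; T?; decidable-stable)
open import Data.Bool.ListAction using (all; any)
open import Relation.Binary.PropositionalEquality hiding ([_])
import Algebra.Properties.CommutativeMonoid.Sum as CommutativeMonoidSum

open CommutativeMonoidSum +-0-commutativeMonoid
  using (sum-cong-≗; sum-replicate-zero; ∑-distrib-+; ∑-comm; ∑-permute)
  renaming (sum to ∑)
import Data.Fin.Permutation as Perm
open import Data.Fin.Permutation.Components using (transpose)
import Algebra.Properties.CommutativeSemigroup +-commutativeSemigroup as +-CS
open +-CS using (interchange)
import Algebra.Properties.CommutativeSemigroup *-commutativeSemigroup as *-CS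
open import Data.Nat.Solver using (module +-*-Solver)
open +-*-Solver using (solve; _:+_; _:*_; _:=_; con)

𝟙 : Bool → ℕ
𝟙 true  = 1
𝟙 false = 0

𝟙≤1 : ∀ b → 𝟙 b ≤ 1
𝟙≤1 true  = s≤s z≤n
𝟙≤1 false = z≤n

isYes-true⁺ : ∀ {P : Set} (P? : Dec P) → P → ⌊ P? ⌋ ≡ true
isYes-true⁺ (yes _) _ = refl
isYes-true⁺ (no ¬p) p = contradiction p ¬p

isYes-false⁺ : ∀ {P : Set} (P? : Dec P) → ¬ P → ⌊ P? ⌋ ≡ false
isYes-false⁺ (yes p) ¬p = contradiction p ¬p
isYes-false⁺ (no _)  _  = refl

isYes-true⁻ : ∀ {P : Set} (P? : Dec P) → ⌊ P? ⌋ ≡ true → P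
isYes-true⁻ (yes p) _ = p

isYes-false⁻ : ∀ {P : Set} (P? : Dec P) → ⌊ P? ⌋ ≡ false → ¬ P
isYes-false⁻ (no ¬p) _ = ¬p

eqF-refl : ∀ {n} (i : Fin n) → eqF i i ≡ true
eqF-refl i = isYes-true⁺ (i ≟ᶠ i) refl

⇔-true⇒≡ : ∀ {a b} → (a ≡ true → b ≡ true) → (b ≡ true → a ≡ true) → a ≡ b
⇔-true⇒≡ {true}  a⇒b _   = sym (a⇒b refl)
⇔-true⇒≡ {false} {true}  _ b⇒a = b⇒a refl
⇔-true⇒≡ {false} {false} _ _   = refl

≢true⇒≡false : ∀ {b} → ¬ (b ≡ true) → b ≡ false
≢true⇒≡false {true}  b≢true = contradiction refl b≢true
≢true⇒≡false {false} _      = refl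

≢false⇒≡true : ∀ {b} → ¬ (b ≡ false) → b ≡ true
≢false⇒≡true {true}  _       = refl
≢false⇒≡true {false} b≢false = contradiction refl b≢false

𝟙≡1⇒true : ∀ {b} → 𝟙 b ≡ 1 → b ≡ true
𝟙≡1⇒true {true} _ = refl

T⇒≡true : ∀ {b} → T b → b ≡ true
T⇒≡true = Equivalence.to T-≡

≡true⇒T : ∀ {b} → b ≡ true → T b
≡true⇒T = Equivalence.from T-≡

∨-true⁻ : ∀ a {b} → a ∨ b ≡ true → a ≡ true ⊎ b ≡ true
∨-true⁻ true  _ = inj₁ refl
∨-true⁻ false e = inj₂ e

module _ {A : Set} (p : A → Bool) where

  all-true⁻ : ∀ xs → all p xs ≡ true → ∀ {x} → x ∈ xs → p x ≡ true
  all-true⁻ xs all≡true x∈xs = T⇒≡true (All.lookup (all⁺ p xs (≡true⇒T all≡true)) x∈xs)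

  all-true⁺ : ∀ xs → (∀ {x} → x ∈ xs → p x ≡ true) → all p xs ≡ true
  all-true⁺ _ h = T⇒≡true (all⁻ p (All.tabulate (≡true⇒T ∘ h)))

  any-true⁻ : ∀ xs → any p xs ≡ true → ∃[ x ] x ∈ xs × p x ≡ true
  any-true⁻ xs any≡true with find (any⁻ p xs (≡true⇒T any≡true))
  ... | x , x∈xs , px = x , x∈xs , T⇒≡true px

  any-true⁺ : ∀ xs {x} → x ∈ xs → p x ≡ true → any p xs ≡ true
  any-true⁺ _ x∈xs px = T⇒≡true (any⁺ p (lose x∈xs (≡true⇒T px)))

∈-pairs : ∀ {f} (i j : Fin f) → (i , j) ∈ pairs f
∈-pairs i j = ∈-cartesianProduct⁺ (∈-allFin i) (∈-allFin j)

vec-ext : ∀ {A : Set} {k} {a b : Vec A k} → (∀ i → lookup a i ≡ lookup b i) → a ≡ b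
vec-ext {a = a} {b} a≗b = trans (sym (Vecₚ.tabulate∘lookup a)) (trans (Vecₚ.tabulate-cong a≗b) (Vecₚ.tabulate∘lookup b))

infix 4 _≈[_]_

_≈[_]_ : ℕ → ℕ → ℕ → Set
x ≈[ e ] y = x ≤ y + e × y ≤ x + e

≈-refl : ∀ {x} e → x ≈[ e ] x
≈-refl {x} e = m≤m+n x e , m≤m+n x e

≈-sym : ∀ {x y e} → x ≈[ e ] y → y ≈[ e ] x
≈-sym (x≤y+e , y≤x+e) = y≤x+e , x≤y+e

≈-trans : ∀ {x y z d e} → x ≈[ d ] y → y ≈[ e ] z → x ≈[ d + e ] z
≈-trans {x} {y} {z} {d} {e} (x≤y+d , y≤x+d) (y≤z+e , z≤y+e) =
  ≤-trans x≤y+d (≤-trans (+-monoˡ-≤ d y≤z+e) (≤-reflexive (trans (+-assoc z e d) (cong (z +_) (+-comm e d))))) ,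
  ≤-trans z≤y+e (≤-trans (+-monoˡ-≤ e y≤x+d) (≤-reflexive (+-assoc x d e)))

≈-weaken : ∀ {x y d e} → d ≤ e → x ≈[ d ] y → x ≈[ e ] y
≈-weaken d≤e (x≤y+d , y≤x+d) = ≤-trans x≤y+d (+-monoʳ-≤ _ d≤e) , ≤-trans y≤x+d (+-monoʳ-≤ _ d≤e)

≈-+ : ∀ {x y x′ y′ d e} → x ≈[ d ] y → x′ ≈[ e ] y′ → x + x′ ≈[ d + e ] y + y′
≈-+ {x} {y} {x′} {y′} {d} {e} (x≤y+d , y≤x+d) (x′≤y′+e , y′≤x′+e) =
  ≤-trans (+-mono-≤ x≤y+d x′≤y′+e) (≤-reflexive (interchange y d y′ e)) ,
  ≤-trans (+-mono-≤ y≤x+d y′≤x′+e) (≤-reflexive (interchange x d x′ e))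

≈-cancelˡ : ∀ k {x y e z} → suc k * x ≈[ e ] suc k * y → e ≤ suc k * z → x ≈[ z ] y
≈-cancelˡ k {x} {y} {e} {z} (x≤y+e , y≤x+e) e≤kz = cancel x≤y+e , cancel y≤x+e
  where
  cancel : ∀ {u v} → suc k * u ≤ suc k * v + e → u ≤ v + z
  cancel {u} {v} ku≤kv+e = *-cancelˡ-≤ (suc k)
    (≤-trans ku≤kv+e (≤-trans (+-monoʳ-≤ _ e≤kz) (≤-reflexive (sym (*-distribˡ-+ (suc k) v z)))))

∣-∣-suc-< : ∀ x y → y < x → ∣ x - suc y ∣ < ∣ x - y ∣
∣-∣-suc-< (suc x) zero    _           rewrite ∣-∣-identityʳ x = ≤-refl
∣-∣-suc-< (suc x) (suc y) (s≤s y<x) = ∣-∣-suc-< x y y<x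

∣-∣-suc-> : ∀ x y → x ≤ y → ∣ x - y ∣ < ∣ x - suc y ∣
∣-∣-suc-> zero    y       _         = ≤-refl
∣-∣-suc-> (suc x) (suc y) (s≤s x≤y) = ∣-∣-suc-> x y x≤y

≈⇒∣-∣≤ : ∀ {x y c} → x ≈[ c ] y → ∣ x - y ∣ ≤ c
≈⇒∣-∣≤ {zero}  {y}     (_ , y≤c) = y≤c
≈⇒∣-∣≤ {suc x} {zero}  (x≤c , _) = x≤c
≈⇒∣-∣≤ {suc x} {suc y} (s≤s x≤y+c , s≤s y≤x+c) = ≈⇒∣-∣≤ {x} {y} (x≤y+c , y≤x+c)

∑-zero : ∀ {n} {g : Fin n → ℕ} → (∀ i → g i ≡ 0) → ∑ g ≡ 0
∑-zero {n} g≗0 = trans (sum-cong-≗ g≗0) (sum-replicate-zero n)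

∑-mono-≤ : ∀ {n} {g h : Fin n → ℕ} → (∀ i → g i ≤ h i) → ∑ g ≤ ∑ h
∑-mono-≤ {zero}  _   = z≤n
∑-mono-≤ {suc n} g≤h = +-mono-≤ (g≤h zero) (∑-mono-≤ (g≤h ∘ suc))

∑-mono-< : ∀ {n} {g h : Fin n → ℕ} (u : Fin n) → (∀ i → g i ≤ h i) → g u < h u → ∑ g < ∑ h
∑-mono-< zero    g≤h gu<hu = +-mono-<-≤ gu<hu (∑-mono-≤ (g≤h ∘ suc))
∑-mono-< (suc u) g≤h gu<hu = +-mono-≤-< (g≤h zero) (∑-mono-< u (g≤h ∘ suc) gu<hu)

∑-bounded : ∀ {n} {g : Fin n → ℕ} (B : ℕ) → (∀ i → g i ≤ B) → ∑ g ≤ n * B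
∑-bounded {zero}  B _   = z≤n
∑-bounded {suc n} B g≤B = +-mono-≤ (g≤B zero) (∑-bounded B (g≤B ∘ suc))

term≤∑ : ∀ {n} (g : Fin n → ℕ) (u : Fin n) → g u ≤ ∑ g
term≤∑ g zero    = m≤m+n (g zero) _
term≤∑ g (suc u) = ≤-trans (term≤∑ (g ∘ suc) u) (m≤n+m _ (g zero))

∑-*ʳ : ∀ {n} (c : ℕ) (g : Fin n → ℕ) → ∑ (λ i → g i * c) ≡ ∑ g * c
∑-*ʳ {zero}  c g = refl
∑-*ʳ {suc n} c g = trans (cong (g zero * c +_) (∑-*ʳ c (g ∘ suc))) (sym (*-distribʳ-+ c (g zero) _))

∑-single : ∀ {n} {g : Fin n → ℕ} (u : Fin n) → (∀ i → i ≢ u → g i ≡ 0) → ∑ g ≡ g u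
∑-single {suc n} {g} zero    g≡0 = trans (cong (g zero +_) (∑-zero (λ i → g≡0 (suc i) λ ()))) (+-identityʳ _)
∑-single {suc n} {g} (suc u) g≡0 =
  cong₂ _+_ (g≡0 zero λ ()) (∑-single u (λ i i≢u → g≡0 (suc i) (i≢u ∘ Finₚ.suc-injective)))

∑-const : ∀ n → ∑ {n} (λ _ → 1) ≡ n
∑-const zero    = refl
∑-const (suc n) = cong suc (∑-const n)

∑-pos : ∀ {n} (g : Fin n → ℕ) → 1 ≤ ∑ g → ∃[ u ] 1 ≤ g u
∑-pos {suc n} g 1≤∑ with g zero in eq
... | suc _ = zero , subst (1 ≤_) (sym eq) (s≤s z≤n)
... | zero  with ∑-pos (g ∘ suc) 1≤∑
...   | u , 1≤gu = suc u , 1≤gu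

∑-≤1 : ∀ {n} {g : Fin n → ℕ} → (∀ i → g i ≤ 1) → (∀ i j → g i ≡ 1 → g j ≡ 1 → i ≡ j) → ∑ g ≤ 1
∑-≤1 {zero}      _   _    = z≤n
∑-≤1 {suc n} {g} g≤1 uniq with n≤1⇒n≡0∨n≡1 (g≤1 zero)
... | inj₁ g0≡0 = subst (λ x → x + ∑ (g ∘ suc) ≤ 1) (sym g0≡0)
                    (∑-≤1 (g≤1 ∘ suc) (λ i j gi gj → Finₚ.suc-injective (uniq (suc i) (suc j) gi gj)))
... | inj₂ g0≡1 = ≤-reflexive (cong₂ _+_ g0≡1 (∑-zero rest))
  where
  rest : ∀ i → g (suc i) ≡ 0
  rest i with n≤1⇒n≡0∨n≡1 (g≤1 (suc i))
  ... | inj₁ gi≡0 = gi≡0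
  ... | inj₂ gi≡1 with () ← uniq zero (suc i) g0≡1 gi≡1

∑-permute-involution : ∀ {n} (σ : Fin n → Fin n) → (∀ i → σ (σ i) ≡ i) → (g : Fin n → ℕ) →
  ∑ (g ∘ σ) ≡ ∑ g
∑-permute-involution σ σσ g = sym (∑-permute g (Perm.permutation σ σ σσ σσ))

∑-update : ∀ {n} {g h : Fin n → ℕ} (w : Fin n) → (∀ i → i ≢ w → g i ≡ h i) → ∑ g + h w ≡ ∑ h + g w
∑-update {suc n} {g} {h} zero g≗h = begin
  g zero + ∑ (g ∘ suc) + h zero  ≡⟨ cong (λ s → g zero + s + h zero) (sum-cong-≗ (λ i → g≗h (suc i) λ ())) ⟩
  g zero + ∑ (h ∘ suc) + h zero  ≡⟨ +-CS.xy∙z≈zy∙x (g zero) _ (h zero) ⟩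
  h zero + ∑ (h ∘ suc) + g zero  ∎
  where open ≡-Reasoning
∑-update {suc n} {g} {h} (suc w) g≗h = begin
  g zero + ∑ (g ∘ suc) + h (suc w)    ≡⟨ +-assoc (g zero) _ _ ⟩
  g zero + (∑ (g ∘ suc) + h (suc w))  ≡⟨ cong₂ _+_ (g≗h zero λ ())
                                          (∑-update w (λ i i≢w → g≗h (suc i) (i≢w ∘ Finₚ.suc-injective))) ⟩
  h zero + (∑ (h ∘ suc) + g (suc w))  ≡⟨ +-assoc (h zero) _ _ ⟨
  h zero + ∑ (h ∘ suc) + g (suc w)    ∎
  where open ≡-Reasoning

∑ᵛ : ∀ {n} f → (Vec (Fin n) f → ℕ) → ℕ
∑ᵛ zero    g = g []
∑ᵛ (suc f) g = ∑ (λ x → ∑ᵛ f (g ∘ (x ∷_)))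

∑ᵛ-cong : ∀ {n} f {g h : Vec (Fin n) f → ℕ} → (∀ φ → g φ ≡ h φ) → ∑ᵛ f g ≡ ∑ᵛ f h
∑ᵛ-cong zero    g≗h = g≗h []
∑ᵛ-cong (suc f) g≗h = sum-cong-≗ (λ x → ∑ᵛ-cong f (g≗h ∘ (x ∷_)))

∑ᵛ-mono-≤ : ∀ {n} f {g h : Vec (Fin n) f → ℕ} → (∀ φ → g φ ≤ h φ) → ∑ᵛ f g ≤ ∑ᵛ f h
∑ᵛ-mono-≤ zero    g≤h = g≤h []
∑ᵛ-mono-≤ (suc f) g≤h = ∑-mono-≤ (λ x → ∑ᵛ-mono-≤ f (g≤h ∘ (x ∷_)))

∑ᵛ-zero : ∀ {n} f {g : Vec (Fin n) f → ℕ} → (∀ φ → g φ ≡ 0) → ∑ᵛ f g ≡ 0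
∑ᵛ-zero zero    g≡0 = g≡0 []
∑ᵛ-zero (suc f) g≡0 = ∑-zero (λ x → ∑ᵛ-zero f (g≡0 ∘ (x ∷_)))

∑ᵛ-distrib-+ : ∀ {n} f (g h : Vec (Fin n) f → ℕ) → ∑ᵛ f (λ φ → g φ + h φ) ≡ ∑ᵛ f g + ∑ᵛ f h
∑ᵛ-distrib-+ zero    g h = refl
∑ᵛ-distrib-+ {n} (suc f) g h =
  trans (sum-cong-≗ (λ x → ∑ᵛ-distrib-+ f (g ∘ (x ∷_)) (h ∘ (x ∷_)))) (∑-distrib-+ {n} _ _)

∑ᵛ-bounded : ∀ {n} f {g : Vec (Fin n) f → ℕ} (B : ℕ) → (∀ φ → g φ ≤ B) → ∑ᵛ f g ≤ n ^ f * B
∑ᵛ-bounded     zero    B g≤B = ≤-trans (g≤B []) (≤-reflexive (sym (+-identityʳ B)))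
∑ᵛ-bounded {n} (suc f) B g≤B = ≤-trans (∑-bounded _ (λ x → ∑ᵛ-bounded f B (g≤B ∘ (x ∷_))))
                                        (≤-reflexive (sym (*-assoc n (n ^ f) B)))

term≤∑ᵛ : ∀ {n} f (g : Vec (Fin n) f → ℕ) (φ : Vec (Fin n) f) → g φ ≤ ∑ᵛ f g
term≤∑ᵛ zero    g []      = ≤-refl
term≤∑ᵛ (suc f) g (x ∷ φ) = ≤-trans (term≤∑ᵛ f (g ∘ (x ∷_)) φ) (term≤∑ (λ y → ∑ᵛ f (g ∘ (y ∷_))) x)

∑ᵛ-∑-comm : ∀ {n m} f (g : Fin m → Vec (Fin n) f → ℕ) →
  ∑ᵛ f (λ φ → ∑ (λ i → g i φ)) ≡ ∑ (λ i → ∑ᵛ f (g i))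
∑ᵛ-∑-comm zero    g = refl
∑ᵛ-∑-comm {n} {m} (suc f) g = trans (sum-cong-≗ (λ x → ∑ᵛ-∑-comm f (λ i → g i ∘ (x ∷_)))) (∑-comm {n} {m} _)

∑ᵛ-comm : ∀ {n m} f k (g : Vec (Fin n) f → Vec (Fin m) k → ℕ) →
  ∑ᵛ f (λ φ → ∑ᵛ k (g φ)) ≡ ∑ᵛ k (λ ψ → ∑ᵛ f (λ φ → g φ ψ))
∑ᵛ-comm zero    k g = refl
∑ᵛ-comm (suc f) k g = trans (sum-cong-≗ (λ x → ∑ᵛ-comm f k (g ∘ (x ∷_))))
                            (sym (∑ᵛ-∑-comm k (λ x ψ → ∑ᵛ f (λ φ → g (x ∷ φ) ψ))))

∑ᵛ-pos : ∀ {n} f (g : Vec (Fin n) f → ℕ) → 1 ≤ ∑ᵛ f g → ∃[ φ ] 1 ≤ g φ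
∑ᵛ-pos zero    g 1≤g = [] , 1≤g
∑ᵛ-pos (suc f) g 1≤∑ with ∑-pos _ 1≤∑
... | x , 1≤gx with ∑ᵛ-pos f (g ∘ (x ∷_)) 1≤gx
...   | φ , 1≤gφ = x ∷ φ , 1≤gφ

∑ᵛ-≤1 : ∀ {n} f {g : Vec (Fin n) f → ℕ} → (∀ φ → g φ ≤ 1) → (∀ φ ψ → g φ ≡ 1 → g ψ ≡ 1 → φ ≡ ψ) →
  ∑ᵛ f g ≤ 1
∑ᵛ-≤1 zero    g≤1 _    = g≤1 []
∑ᵛ-≤1 (suc f) {g} g≤1 uniq =
  ∑-≤1 (λ x → ∑ᵛ-≤1 f (g≤1 ∘ (x ∷_)) (λ φ ψ gφ gψ → Vecₚ.∷-injectiveʳ (uniq _ _ gφ gψ))) head-unique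
  where
  head-unique : ∀ x y → ∑ᵛ f (g ∘ (x ∷_)) ≡ 1 → ∑ᵛ f (g ∘ (y ∷_)) ≡ 1 → x ≡ y
  head-unique x y ∑x≡1 ∑y≡1 with ∑ᵛ-pos f (g ∘ (x ∷_)) (≤-reflexive (sym ∑x≡1))
                               | ∑ᵛ-pos f (g ∘ (y ∷_)) (≤-reflexive (sym ∑y≡1))
  ... | φ , 1≤gφ | ψ , 1≤gψ =
    Vecₚ.∷-injectiveˡ (uniq _ _ (≤-antisym (g≤1 _) 1≤gφ) (≤-antisym (g≤1 _) 1≤gψ))

∑ᵛ-permute-involution : ∀ {n} f (σ : Fin n → Fin n) → (∀ i → σ (σ i) ≡ i) → (g : Vec (Fin n) f → ℕ) →
  ∑ᵛ f (g ∘ Data.Vec.map σ) ≡ ∑ᵛ f g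
∑ᵛ-permute-involution zero    σ σσ g = refl
∑ᵛ-permute-involution (suc f) σ σσ g =
  trans (sum-cong-≗ (λ x → ∑ᵛ-permute-involution f σ σσ (g ∘ (σ x ∷_))))
        (∑-permute-involution σ σσ (λ y → ∑ᵛ f (g ∘ (y ∷_))))

count : ∀ {n} f → (Vec (Fin n) f → Bool) → ℕ
count f P = ∑ᵛ f (𝟙 ∘ P)

∑ˡ : ∀ {A : Set} → List A → (A → ℕ) → ℕ
∑ˡ L g = sum (map g L)

module _ {A : Set} where

  ∑ˡ-cong : ∀ (L : List A) {g h : A → ℕ} → (∀ x → x ∈ L → g x ≡ h x) → ∑ˡ L g ≡ ∑ˡ L h
  ∑ˡ-cong []      _   = refl
  ∑ˡ-cong (x ∷ L) g≗h = cong₂ _+_ (g≗h x (here refl)) (∑ˡ-cong L (λ y y∈L → g≗h y (there y∈L)))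

  ∑ˡ-mono-≤ : ∀ (L : List A) {g h : A → ℕ} → (∀ x → x ∈ L → g x ≤ h x) → ∑ˡ L g ≤ ∑ˡ L h
  ∑ˡ-mono-≤ []      _   = z≤n
  ∑ˡ-mono-≤ (x ∷ L) g≤h = +-mono-≤ (g≤h x (here refl)) (∑ˡ-mono-≤ L (λ y y∈L → g≤h y (there y∈L)))

  ∑ˡ-bounded : ∀ (L : List A) {g : A → ℕ} (B : ℕ) → (∀ x → x ∈ L → g x ≤ B) → ∑ˡ L g ≤ length L * B
  ∑ˡ-bounded []      B _   = z≤n
  ∑ˡ-bounded (x ∷ L) B g≤B = +-mono-≤ (g≤B x (here refl)) (∑ˡ-bounded L B (λ y y∈L → g≤B y (there y∈L)))

  ∑ˡ-const : ∀ (L : List A) (c : ℕ) → ∑ˡ L (λ _ → c) ≡ length L * c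
  ∑ˡ-const []      c = refl
  ∑ˡ-const (x ∷ L) c = cong (c +_) (∑ˡ-const L c)

  term≤∑ˡ : ∀ {L : List A} (g : A → ℕ) {x : A} → x ∈ L → g x ≤ ∑ˡ L g
  term≤∑ˡ {y ∷ L} g (here refl) = m≤m+n (g y) _
  term≤∑ˡ {y ∷ L} g (there x∈L) = ≤-trans (term≤∑ˡ g x∈L) (m≤n+m _ (g y))

  ∑ˡ-distrib-+ : ∀ (L : List A) (g h : A → ℕ) → ∑ˡ L (λ x → g x + h x) ≡ ∑ˡ L g + ∑ˡ L h
  ∑ˡ-distrib-+ []      g h = refl
  ∑ˡ-distrib-+ (x ∷ L) g h = trans (cong (g x + h x +_) (∑ˡ-distrib-+ L g h)) (interchange (g x) (h x) _ _)

  ∑ˡ-*ʳ : ∀ (L : List A) (g : A → ℕ) (c : ℕ) → ∑ˡ L (λ x → g x * c) ≡ ∑ˡ L g * c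
  ∑ˡ-*ʳ []      g c = refl
  ∑ˡ-*ʳ (x ∷ L) g c = trans (cong (g x * c +_) (∑ˡ-*ʳ L g c)) (sym (*-distribʳ-+ c (g x) (∑ˡ L g)))

  ∑ˡ-≤1 : ∀ (L : List A) {g : A → ℕ} → Unique L → (∀ x → g x ≤ 1) →
    (∀ x y → x ∈ L → y ∈ L → g x ≡ 1 → g y ≡ 1 → x ≡ y) → ∑ˡ L g ≤ 1
  ∑ˡ-≤1 []          _            _   _    = z≤n
  ∑ˡ-≤1 (x ∷ L) {g} (x∉L ∷ uniqL) g≤1 uniq with n≤1⇒n≡0∨n≡1 (g≤1 x)
  ... | inj₁ gx≡0 = subst (λ z → z + ∑ˡ L g ≤ 1) (sym gx≡0)
                      (∑ˡ-≤1 L uniqL g≤1 (λ y z y∈L z∈L → uniq y z (there y∈L) (there z∈L)))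
  ... | inj₂ gx≡1 = subst (λ z → z + ∑ˡ L g ≤ 1) (sym gx≡1)
                      (s≤s (≤-trans (∑ˡ-bounded L 0 rest) (≤-reflexive (*-zeroʳ (length L)))))
    where
    rest : ∀ y → y ∈ L → g y ≤ 0
    rest y y∈L with n≤1⇒n≡0∨n≡1 (g≤1 y)
    ... | inj₁ gy≡0 = ≤-reflexive gy≡0
    ... | inj₂ gy≡1 = contradiction (uniq x y (here refl) (there y∈L) gx≡1 gy≡1) (All.lookup x∉L y∈L)

  ∑ᵛ-∑ˡ-comm : ∀ {n} f (L : List A) (g : A → Vec (Fin n) f → ℕ) →
    ∑ᵛ f (λ φ → ∑ˡ L (λ x → g x φ)) ≡ ∑ˡ L (λ x → ∑ᵛ f (g x))
  ∑ᵛ-∑ˡ-comm f []      g = ∑ᵛ-zero f (λ _ → refl)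
  ∑ᵛ-∑ˡ-comm f (x ∷ L) g = trans (∑ᵛ-distrib-+ f (g x) _) (cong (∑ᵛ f (g x) +_) (∑ᵛ-∑ˡ-comm f L g))

  ∑ˡ-++ : ∀ (L K : List A) (g : A → ℕ) → ∑ˡ (L ++ K) g ≡ ∑ˡ L g + ∑ˡ K g
  ∑ˡ-++ []      K g = refl
  ∑ˡ-++ (x ∷ L) K g = trans (cong (g x +_) (∑ˡ-++ L K g)) (sym (+-assoc (g x) _ _))

  length-filterᵇ : ∀ (P : A → Bool) (L : List A) → length (filterᵇ P L) ≡ ∑ˡ L (𝟙 ∘ P)
  length-filterᵇ P []      = refl
  length-filterᵇ P (x ∷ L) with P x
  ... | true  = cong suc (length-filterᵇ P L)
  ... | false = length-filterᵇ P L

∑ˡ-concatMap : ∀ {A B : Set} (L : List A) (h : A → List B) (g : B → ℕ) →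
  ∑ˡ (concatMap h L) g ≡ ∑ˡ L (λ x → ∑ˡ (h x) g)
∑ˡ-concatMap []      h g = refl
∑ˡ-concatMap (x ∷ L) h g = trans (∑ˡ-++ (h x) (concatMap h L) g) (cong (∑ˡ (h x) g +_) (∑ˡ-concatMap L h g))

∑ˡ-map : ∀ {A B : Set} (L : List A) (h : A → B) (g : B → ℕ) → ∑ˡ (map h L) g ≡ ∑ˡ L (g ∘ h)
∑ˡ-map L h g = cong sum (sym (Listₚ.map-∘ L))

∑ˡ-tabulate : ∀ {n} {B : Set} (h : Fin n → B) (g : B → ℕ) → ∑ˡ (Data.List.tabulate h) g ≡ ∑ (g ∘ h)
∑ˡ-tabulate {zero}  h g = refl
∑ˡ-tabulate {suc n} h g = cong (g (h zero) +_) (∑ˡ-tabulate (h ∘ suc) g)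

∑ˡ-allVecs : ∀ f {n} (g : Vec (Fin n) f → ℕ) → ∑ˡ (allVecs f n) g ≡ ∑ᵛ f g
∑ˡ-allVecs zero    g = +-identityʳ (g [])
∑ˡ-allVecs (suc f) {n} g = begin
  ∑ˡ (concatMap (λ x → map (x ∷_) (allVecs f n)) (allFin n)) g  ≡⟨ ∑ˡ-concatMap (allFin n) _ g ⟩
  ∑ˡ (allFin n) (λ x → ∑ˡ (map (x ∷_) (allVecs f n)) g)         ≡⟨ ∑ˡ-tabulate {n} (λ x → x) _ ⟩
  ∑ (λ x → ∑ˡ (map (x ∷_) (allVecs f n)) g)                     ≡⟨ sum-cong-≗ allVecs-from ⟩
  ∑ᵛ {n} (suc f) g                                               ∎
  where
  open ≡-Reasoning
  allVecs-from : ∀ x → ∑ˡ (map (x ∷_) (allVecs f n)) g ≡ ∑ᵛ f (g ∘ (x ∷_))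
  allVecs-from x = trans (∑ˡ-map (allVecs f n) (x ∷_) g) (∑ˡ-allVecs f (g ∘ (x ∷_)))

∑ᵛ-+-*ʳ : ∀ {n} f (g h : Vec (Fin n) f → ℕ) (c : ℕ) → ∑ᵛ f (λ φ → g φ + h φ) * c ≡ ∑ᵛ f g * c + ∑ᵛ f h * c
∑ᵛ-+-*ʳ f g h c = trans (cong (_* c) (∑ᵛ-distrib-+ f g h)) (*-distribʳ-+ c (∑ᵛ f g) (∑ᵛ f h))

∑ᵛ-∑ˡ-*ʳ : ∀ {n A} f (L : List A) (g : A → Vec (Fin n) f → ℕ) (c : ℕ) →
  ∑ᵛ f (λ φ → ∑ˡ L (λ x → g x φ)) * c ≡ ∑ˡ L (λ x → ∑ᵛ f (g x) * c)
∑ᵛ-∑ˡ-*ʳ f L g c = trans (cong (_* c) (∑ᵛ-∑ˡ-comm f L g)) (sym (∑ˡ-*ʳ L (∑ᵛ f ∘ g) c))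

∑ᵛ-∑ˡ²-bounded : ∀ {n A B} f (L : List A) (K : List B) (h : A → B → Vec (Fin n) f → ℕ) (c b : ℕ) →
  (∀ {x y} → x ∈ L → y ∈ K → ∑ᵛ f (h x y) * c ≤ b) →
  ∑ᵛ f (λ φ → ∑ˡ L (λ x → ∑ˡ K (λ y → h x y φ))) * c ≤ length L * (length K * b)
∑ᵛ-∑ˡ²-bounded f L K h c b h≤b = begin
  ∑ᵛ f (λ φ → ∑ˡ L (λ x → ∑ˡ K (λ y → h x y φ))) * c  ≡⟨ ∑ᵛ-∑ˡ-*ʳ f L _ c ⟩
  ∑ˡ L (λ x → ∑ᵛ f (λ φ → ∑ˡ K (λ y → h x y φ)) * c)  ≡⟨ ∑ˡ-cong L (λ x _ → ∑ᵛ-∑ˡ-*ʳ f K (h x) c) ⟩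
  ∑ˡ L (λ x → ∑ˡ K (λ y → ∑ᵛ f (h x y) * c))          ≤⟨ ∑ˡ-bounded L _ (λ _ x∈L → ∑ˡ-bounded K b (λ _ → h≤b x∈L)) ⟩
  length L * (length K * b)                           ∎
  where open ≤-Reasoning

length-filterᵇ-allVecs : ∀ f {n} (P : Vec (Fin n) f → Bool) → length (filterᵇ P (allVecs f n)) ≡ count f P
length-filterᵇ-allVecs f P = trans (length-filterᵇ P (allVecs f _)) (∑ˡ-allVecs f (𝟙 ∘ P))

∑ˡ-≈ : ∀ {A : Set} (L : List A) {x : A → ℕ} {X b : ℕ} → (∀ a → a ∈ L → x a ≈[ b ] X) →
  ∑ˡ L x ≈[ length L * b ] length L * X
∑ˡ-≈ []      _   = ≈-refl 0
∑ˡ-≈ (a ∷ L) x≈X = ≈-+ (x≈X a (here refl)) (∑ˡ-≈ L (λ a′ a′∈L → x≈X a′ (there a′∈L)))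

-- Embeddings, images and automorphisms

Injectiveᵛ : ∀ {f n} → Vec (Fin n) f → Set
Injectiveᵛ φ = ∀ i j → lookup φ i ≡ lookup φ j → i ≡ j

EdgePreserving : ∀ {f n} → Adj f → Adj n → Vec (Fin n) f → Set
EdgePreserving AF AG φ = ∀ i j → AF i j ≡ true → AG (lookup φ i) (lookup φ j) ≡ true

module _ {f n : ℕ} (AF : Adj f) (AG : Adj n) (φ : Vec (Fin n) f) where

  isEmbedding⇒injective : isEmbedding AF AG φ ≡ true → Injectiveᵛ φ
  isEmbedding⇒injective emb i j φi≡φj =
    isYes-true⁻ (i ≟ᶠ j) (distinct (all-true⁻ _ (pairs f) (Boolₚ.∧-conicalˡ _ _ emb) (∈-pairs i j)))
    where
    distinct : not (eqF (lookup φ i) (lookup φ j)) ∨ eqF i j ≡ true → eqF i j ≡ true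
    distinct h rewrite φi≡φj | eqF-refl (lookup φ j) = h

  isEmbedding⇒edge-preserving : isEmbedding AF AG φ ≡ true → EdgePreserving AF AG φ
  isEmbedding⇒edge-preserving emb i j ij∈F = edge (all-true⁻ _ (pairs f) (Boolₚ.∧-conicalʳ _ _ emb) (∈-pairs i j))
    where
    edge : not (AF i j) ∨ AG (lookup φ i) (lookup φ j) ≡ true → AG (lookup φ i) (lookup φ j) ≡ true
    edge h rewrite ij∈F = h

  isEmbedding-intro : Injectiveᵛ φ → EdgePreserving AF AG φ → isEmbedding AF AG φ ≡ true
  isEmbedding-intro inj hom =
    cong₂ _∧_ (all-true⁺ _ (pairs f) λ { {i , j} _ → distinct i j }) (all-true⁺ _ (pairs f) λ { {i , j} _ → edge i j })
    where
    distinct : ∀ i j → not (eqF (lookup φ i) (lookup φ j)) ∨ eqF i j ≡ true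
    distinct i j with lookup φ i ≟ᶠ lookup φ j
    ... | yes φi≡φj = isYes-true⁺ (i ≟ᶠ j) (inj i j φi≡φj)
    ... | no  _     = refl
    edge : ∀ i j → not (AF i j) ∨ AG (lookup φ i) (lookup φ j) ≡ true
    edge i j with AF i j in ij∈F
    ... | true  = hom i j ij∈F
    ... | false = refl

isEmbedding-cong : ∀ {f n} (AF : Adj f) {AG AG′ : Adj n} → (∀ u v → AG u v ≡ AG′ u v) →
  (φ : Vec (Fin n) f) → isEmbedding AF AG φ ≡ isEmbedding AF AG′ φ
isEmbedding-cong AF {AG} {AG′} AG≗AG′ φ = ⇔-true⇒≡ (transfer AG≗AG′) (transfer (λ u v → sym (AG≗AG′ u v)))
  where
  transfer : ∀ {A B : Adj _} → (∀ u v → A u v ≡ B u v) → isEmbedding AF A φ ≡ true → isEmbedding AF B φ ≡ true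
  transfer {A} {B} A≗B emb = isEmbedding-intro AF B φ (isEmbedding⇒injective AF A φ emb)
    (λ i j ij∈F → trans (sym (A≗B _ _)) (isEmbedding⇒edge-preserving AF A φ emb i j ij∈F))

#Emb : ∀ {f n} → Adj f → Adj n → ℕ
#Emb {f} AF AG = count f (isEmbedding AF AG)

#Emb-cong : ∀ {f n} (AF : Adj f) {AG AG′ : Adj n} → (∀ u v → AG u v ≡ AG′ u v) → #Emb AF AG ≡ #Emb AF AG′
#Emb-cong {f} AF AG≗AG′ = ∑ᵛ-cong f (cong 𝟙 ∘ isEmbedding-cong AF AG≗AG′)

_≟ᵛ_ : ∀ {n f} (φ ψ : Vec (Fin n) f) → Dec (φ ≡ ψ)
_≟ᵛ_ = Vecₚ.≡-dec _≟ᶠ_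

count-≤-injection : ∀ {n m} f (P : Vec (Fin n) f → Bool) (Q : Vec (Fin m) f → Bool) (α : Vec (Fin n) f → Vec (Fin m) f) →
  (∀ φ → P φ ≡ true → Q (α φ) ≡ true) → (∀ φ ψ → P φ ≡ true → P ψ ≡ true → α φ ≡ α ψ → φ ≡ ψ) →
  count f P ≤ count f Q
count-≤-injection f P Q α P⇒Qα α-injective = begin
  count f P                                          ≤⟨ ∑ᵛ-mono-≤ f hit ⟩
  ∑ᵛ f (λ φ → ∑ᵛ f (λ σ → 𝟙 (fibre σ φ)))            ≡⟨ ∑ᵛ-comm f f _ ⟩
  ∑ᵛ f (λ σ → ∑ᵛ f (λ φ → 𝟙 (fibre σ φ)))            ≤⟨ ∑ᵛ-mono-≤ f fibre-≤1 ⟩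
  count f Q                                          ∎
  where
  open ≤-Reasoning
  fibre : Vec (Fin _) f → Vec (Fin _) f → Bool
  fibre σ φ = P φ ∧ ⌊ σ ≟ᵛ α φ ⌋
  hit : ∀ φ → 𝟙 (P φ) ≤ ∑ᵛ f (λ σ → 𝟙 (fibre σ φ))
  hit φ with P φ in Pφ
  ... | false = z≤n
  ... | true  = ≤-trans (≤-reflexive (cong 𝟙 (sym (isYes-true⁺ (α φ ≟ᵛ α φ) refl)))) (term≤∑ᵛ f _ (α φ))
  in-fibre : ∀ {σ φ} → 𝟙 (fibre σ φ) ≡ 1 → P φ ≡ true × σ ≡ α φ
  in-fibre {σ} {φ} one with P φ | σ ≟ᵛ α φ
  ... | true | yes σ≡αφ = refl , σ≡αφ
  fibre-≤1 : ∀ σ → ∑ᵛ f (λ φ → 𝟙 (fibre σ φ)) ≤ 𝟙 (Q σ)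
  fibre-≤1 σ with Q σ in Qσ
  ... | true  = ∑ᵛ-≤1 f (λ φ → 𝟙≤1 _) λ φ ψ φ∈ ψ∈ →
                  α-injective φ ψ (proj₁ (in-fibre φ∈)) (proj₁ (in-fibre ψ∈))
                              (trans (sym (proj₂ (in-fibre φ∈))) (proj₂ (in-fibre ψ∈)))
  ... | false = ≤-reflexive (∑ᵛ-zero f empty)
    where
    empty : ∀ φ → 𝟙 (fibre σ φ) ≡ 0
    empty φ with n≤1⇒n≡0∨n≡1 (𝟙≤1 (fibre σ φ))
    ... | inj₁ ≡0 = ≡0
    ... | inj₂ one with in-fibre one
    ...   | Pφ , refl with () ← trans (sym Qσ) (P⇒Qα φ Pφ)

_∈ᵛ_ : ∀ {f n} → Fin n → Vec (Fin n) f → Set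
u ∈ᵛ φ = ∃[ i ] lookup φ i ≡ u

_∈ᵛ?_ : ∀ {f n} (u : Fin n) (φ : Vec (Fin n) f) → Dec (u ∈ᵛ φ)
u ∈ᵛ? φ = Finₚ.any? (λ i → lookup φ i ≟ᶠ u)

ImageEdge : ∀ {f n} → Adj f → Vec (Fin n) f → Fin n → Fin n → Set
ImageEdge AF φ x y = ∃[ i ] ∃[ j ] AF i j ≡ true × lookup φ i ≡ x × lookup φ j ≡ y

vertexOf : ∀ {n} → SubgraphRep n → Fin n → Bool
vertexOf R w = lookup (proj₁ R) w

edgeOf : ∀ {n} → SubgraphRep n → Fin n → Fin n → Bool
edgeOf R x y = lookup (lookup (proj₂ R) x) y

SubgraphRep-ext : ∀ {n} (R R′ : SubgraphRep n) → (∀ w → vertexOf R w ≡ vertexOf R′ w) →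
  (∀ x y → edgeOf R x y ≡ edgeOf R′ x y) → R ≡ R′
SubgraphRep-ext (V , E) (V′ , E′) V≗V′ E≗E′ =
  cong₂ _,_ (vec-ext V≗V′) (vec-ext λ x → vec-ext (E≗E′ x))

module _ {f n : ℕ} (AF : Adj f) where

  image-vertex⇔ : ∀ (φ : Vec (Fin n) f) w → vertexOf (image AF φ) w ≡ true ⇔ w ∈ᵛ φ
  image-vertex⇔ φ w = mk⇔ to from
    where
    to : vertexOf (image AF φ) w ≡ true → w ∈ᵛ φ
    to w∈ with any-true⁻ _ (allFin f) (trans (sym (Vecₚ.lookup∘tabulate _ w)) w∈)
    ... | i , _ , φi≡w = i , isYes-true⁻ (lookup φ i ≟ᶠ w) φi≡w
    from : w ∈ᵛ φ → vertexOf (image AF φ) w ≡ true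
    from (i , φi≡w) = trans (Vecₚ.lookup∘tabulate _ w)
      (any-true⁺ _ (allFin f) (∈-allFin i) (isYes-true⁺ (lookup φ i ≟ᶠ w) φi≡w))

  private
    unfold : ∀ (φ : Vec (Fin n) f) x y → edgeOf (image AF φ) x y ≡ any _ (pairs f)
    unfold φ x y = trans (cong (λ row → lookup row y) (Vecₚ.lookup∘tabulate _ x)) (Vecₚ.lookup∘tabulate _ y)

  image-edge⇔ : ∀ (φ : Vec (Fin n) f) x y → edgeOf (image AF φ) x y ≡ true ⇔ ImageEdge AF φ x y
  image-edge⇔ φ x y = mk⇔ to from
    where
    to : edgeOf (image AF φ) x y ≡ true → ImageEdge AF φ x y
    to xy∈ with any-true⁻ _ (pairs f) (trans (sym (unfold φ x y)) xy∈)
    ... | (i , j) , _ , h =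
      i , j , Boolₚ.∧-conicalˡ _ _ h ,
      isYes-true⁻ (lookup φ i ≟ᶠ x) (Boolₚ.∧-conicalˡ _ _ (Boolₚ.∧-conicalʳ (AF i j) _ h)) ,
      isYes-true⁻ (lookup φ j ≟ᶠ y) (Boolₚ.∧-conicalʳ (eqF (lookup φ i) x) _ (Boolₚ.∧-conicalʳ (AF i j) _ h))
    from : ImageEdge AF φ x y → edgeOf (image AF φ) x y ≡ true
    from (i , j , ij∈F , φi≡x , φj≡y) = trans (unfold φ x y) (any-true⁺ _ (pairs f) (∈-pairs i j)
      (cong₂ _∧_ ij∈F (cong₂ _∧_ (isYes-true⁺ (lookup φ i ≟ᶠ x) φi≡x) (isYes-true⁺ (lookup φ j ≟ᶠ y) φj≡y))))

  image-≡ : ∀ (φ ψ : Vec (Fin n) f) → (∀ w → w ∈ᵛ φ ⇔ w ∈ᵛ ψ) →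
    (∀ x y → ImageEdge AF φ x y ⇔ ImageEdge AF ψ x y) → image AF φ ≡ image AF ψ
  image-≡ φ ψ V⇔ E⇔ = SubgraphRep-ext (image AF φ) (image AF ψ)
    (λ w → ⇔-true⇒≡ (from (image-vertex⇔ ψ w) ∘ to (V⇔ w) ∘ to (image-vertex⇔ φ w))
                    (from (image-vertex⇔ φ w) ∘ from (V⇔ w) ∘ to (image-vertex⇔ ψ w)))
    (λ x y → ⇔-true⇒≡ (from (image-edge⇔ ψ x y) ∘ to (E⇔ x y) ∘ to (image-edge⇔ φ x y))
                      (from (image-edge⇔ φ x y) ∘ from (E⇔ x y) ∘ to (image-edge⇔ ψ x y)))
    where open Equivalence

  image-≡⇒∈ᵛ : ∀ (φ ψ : Vec (Fin n) f) → image AF φ ≡ image AF ψ → ∀ {w} → w ∈ᵛ φ → w ∈ᵛ ψ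
  image-≡⇒∈ᵛ φ ψ eq {w} w∈φ = Equivalence.to (image-vertex⇔ ψ w)
    (trans (cong (λ R → vertexOf R w) (sym eq)) (Equivalence.from (image-vertex⇔ φ w) w∈φ))

  image-≡⇒ImageEdge : ∀ (φ ψ : Vec (Fin n) f) → image AF φ ≡ image AF ψ →
    ∀ {x y} → ImageEdge AF φ x y → ImageEdge AF ψ x y
  image-≡⇒ImageEdge φ ψ eq {x} {y} xy∈φ = Equivalence.to (image-edge⇔ ψ x y)
    (trans (cong (λ R → edgeOf R x y) (sym eq)) (Equivalence.from (image-edge⇔ φ x y) xy∈φ))

idᵛ : ∀ f → Vec (Fin f) f
idᵛ f = tabulate (λ i → i)

lookup-idᵛ : ∀ {f} (i : Fin f) → lookup (idᵛ f) i ≡ i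
lookup-idᵛ = Vecₚ.lookup∘tabulate (λ i → i)

isAutomorphism : ∀ {f} → Adj f → Vec (Fin f) f → Bool
isAutomorphism {f} AF σ = isEmbedding AF AF σ ∧ ⌊ ≟Rep (image AF σ) (image AF (idᵛ f)) ⌋

#Aut : ∀ {f} → Adj f → ℕ
#Aut {f} AF = count f (isAutomorphism AF)

module _ {f : ℕ} (AF : Adj f) (σ : Vec (Fin f) f) where

  isAutomorphism⇒isEmbedding : isAutomorphism AF σ ≡ true → isEmbedding AF AF σ ≡ true
  isAutomorphism⇒isEmbedding = Boolₚ.∧-conicalˡ _ _

  private
    image-id : isAutomorphism AF σ ≡ true → image AF (idᵛ f) ≡ image AF σ
    image-id aut = sym (isYes-true⁻ (≟Rep _ _) (Boolₚ.∧-conicalʳ (isEmbedding AF AF σ) _ aut))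

  isAutomorphism⇒surjective : isAutomorphism AF σ ≡ true → ∀ x → x ∈ᵛ σ
  isAutomorphism⇒surjective aut x = image-≡⇒∈ᵛ AF (idᵛ f) σ (image-id aut) (x , lookup-idᵛ x)

  isAutomorphism⇒edge-surjective : isAutomorphism AF σ ≡ true → ∀ x y → AF x y ≡ true → ImageEdge AF σ x y
  isAutomorphism⇒edge-surjective aut x y xy∈F =
    image-≡⇒ImageEdge AF (idᵛ f) σ (image-id aut) (x , y , xy∈F , lookup-idᵛ x , lookup-idᵛ y)

  isAutomorphism-intro : isEmbedding AF AF σ ≡ true → (∀ x → x ∈ᵛ σ) →
    (∀ x y → AF x y ≡ true → ImageEdge AF σ x y) → isAutomorphism AF σ ≡ true
  isAutomorphism-intro emb onto edge-onto = cong₂ _∧_ emb (isYes-true⁺ (≟Rep _ _) (image-≡ AF σ (idᵛ f)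
    (λ w → mk⇔ (λ _ → w , lookup-idᵛ w) (λ _ → onto w))
    (λ x y → mk⇔ (λ (i , j , ij∈F , σi≡x , σj≡y) → x , y , subst₂ (λ u v → AF u v ≡ true) σi≡x σj≡y
                                                              (isEmbedding⇒edge-preserving AF AF σ emb i j ij∈F) ,
                                                      lookup-idᵛ x , lookup-idᵛ y)
                 (λ (i , j , ij∈F , i≡x , j≡y) → edge-onto x y (subst₂ (λ u v → AF u v ≡ true)
                                                      (trans (sym (lookup-idᵛ i)) i≡x) (trans (sym (lookup-idᵛ j)) j≡y) ij∈F)))))

1≤#Aut : ∀ {f} (AF : Adj f) → 1 ≤ #Aut AF
1≤#Aut {f} AF = ≤-trans (≤-reflexive (cong 𝟙 (sym id-aut))) (term≤∑ᵛ f (𝟙 ∘ isAutomorphism AF) (idᵛ f))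
  where
  id-aut : isAutomorphism AF (idᵛ f) ≡ true
  id-aut = isAutomorphism-intro AF (idᵛ f)
    (isEmbedding-intro AF AF (idᵛ f) (λ i j eq → trans (sym (lookup-idᵛ i)) (trans eq (lookup-idᵛ j)))
                                     (λ i j ij∈F → subst₂ (λ u v → AF u v ≡ true) (sym (lookup-idᵛ i)) (sym (lookup-idᵛ j)) ij∈F))
    (λ x → x , lookup-idᵛ x)
    (λ x y xy∈F → x , y , xy∈F , lookup-idᵛ x , lookup-idᵛ y)

module _ {f n : ℕ} (AF : Adj f) (AG : Adj n) (φ₀ : Vec (Fin n) f) (emb₀ : isEmbedding AF AG φ₀ ≡ true) where

  -- The embeddings with the same image as φ₀ are exactly the φ₀ ∘ σ with σ an automorphism.
  sameImage : Vec (Fin n) f → Bool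
  sameImage φ = isEmbedding AF AG φ ∧ ⌊ ≟Rep (image AF φ) (image AF φ₀) ⌋

  private
    inj₀ : Injectiveᵛ φ₀
    inj₀ = isEmbedding⇒injective AF AG φ₀ emb₀

    after₀ : Vec (Fin f) f → Vec (Fin n) f
    after₀ σ = Data.Vec.map (lookup φ₀) σ

    lookup-after₀ : ∀ σ i → lookup (after₀ σ) i ≡ lookup φ₀ (lookup σ i)
    lookup-after₀ σ i = Vecₚ.lookup-map i (lookup φ₀) σ

    preimage₀ : Fin n → Fin f → Fin f
    preimage₀ y default with Finₚ.any? (λ k → lookup φ₀ k ≟ᶠ y)
    ... | yes (k , _) = k
    ... | no  _       = default

    preimage₀-correct : ∀ y default → y ∈ᵛ φ₀ → lookup φ₀ (preimage₀ y default) ≡ y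
    preimage₀-correct y default y∈φ₀ with Finₚ.any? (λ k → lookup φ₀ k ≟ᶠ y)
    ... | yes (k , φ₀k≡y) = φ₀k≡y
    ... | no  y∉φ₀        = contradiction y∈φ₀ y∉φ₀

    before₀ : Vec (Fin n) f → Vec (Fin f) f
    before₀ φ = tabulate (λ i → preimage₀ (lookup φ i) i)

    after₀-sameImage : ∀ σ → isAutomorphism AF σ ≡ true → sameImage (after₀ σ) ≡ true
    after₀-sameImage σ aut = cong₂ _∧_
      (isEmbedding-intro AF AG (after₀ σ)
        (λ i j eq → injσ i j (inj₀ _ _ (trans (sym (lookup-after₀ σ i)) (trans eq (lookup-after₀ σ j)))))
        (λ i j ij∈F → subst₂ (λ u v → AG u v ≡ true) (sym (lookup-after₀ σ i)) (sym (lookup-after₀ σ j))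
                              (isEmbedding⇒edge-preserving AF AG φ₀ emb₀ _ _ (homσ i j ij∈F))))
      (isYes-true⁺ (≟Rep _ _) (image-≡ AF (after₀ σ) φ₀
        (λ w → mk⇔ (λ (i , eq) → lookup σ i , trans (sym (lookup-after₀ σ i)) eq) vertex-onto)
        (λ x y → mk⇔ (λ (i , j , ij∈F , eqi , eqj) → lookup σ i , lookup σ j , homσ i j ij∈F ,
                                                      trans (sym (lookup-after₀ σ i)) eqi , trans (sym (lookup-after₀ σ j)) eqj)
                     edge-onto)))
      where
      embσ = isAutomorphism⇒isEmbedding AF σ aut
      injσ = isEmbedding⇒injective AF AF σ embσ
      homσ = isEmbedding⇒edge-preserving AF AF σ embσ
      vertex-onto : ∀ {w} → w ∈ᵛ φ₀ → w ∈ᵛ after₀ σ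
      vertex-onto (k , eq) with isAutomorphism⇒surjective AF σ aut k
      ... | i , σi≡k = i , trans (lookup-after₀ σ i) (trans (cong (lookup φ₀) σi≡k) eq)
      edge-onto : ∀ {x y} → ImageEdge AF φ₀ x y → ImageEdge AF (after₀ σ) x y
      edge-onto (k , l , kl∈F , eqk , eql) with isAutomorphism⇒edge-surjective AF σ aut k l kl∈F
      ... | i , j , ij∈F , σi≡k , σj≡l = i , j , ij∈F ,
        trans (lookup-after₀ σ i) (trans (cong (lookup φ₀) σi≡k) eqk) ,
        trans (lookup-after₀ σ j) (trans (cong (lookup φ₀) σj≡l) eql)

    after₀-injective : ∀ σ τ → isAutomorphism AF σ ≡ true → isAutomorphism AF τ ≡ true → after₀ σ ≡ after₀ τ → σ ≡ τ
    after₀-injective σ τ _ _ eq =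
      vec-ext (λ i → inj₀ _ _ (trans (sym (lookup-after₀ σ i)) (trans (cong (λ v → lookup v i) eq) (lookup-after₀ τ i))))

    module _ (φ : Vec (Fin n) f) (same : sameImage φ ≡ true) where

      private
        embφ = Boolₚ.∧-conicalˡ (isEmbedding AF AG φ) _ same
        injφ = isEmbedding⇒injective AF AG φ embφ
        image≡ : image AF φ ≡ image AF φ₀
        image≡ = isYes-true⁻ (≟Rep _ _) (Boolₚ.∧-conicalʳ (isEmbedding AF AG φ) _ same)

      after₀∘before₀ : ∀ i → lookup φ₀ (lookup (before₀ φ) i) ≡ lookup φ i
      after₀∘before₀ i = trans (cong (lookup φ₀) (Vecₚ.lookup∘tabulate _ i))
        (preimage₀-correct (lookup φ i) i (image-≡⇒∈ᵛ AF φ φ₀ image≡ (i , refl)))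

      private
        before₀-unique : ∀ i x → lookup φ i ≡ lookup φ₀ x → lookup (before₀ φ) i ≡ x
        before₀-unique i x eq = inj₀ _ _ (trans (after₀∘before₀ i) eq)

      before₀-automorphism : isAutomorphism AF (before₀ φ) ≡ true
      before₀-automorphism = isAutomorphism-intro AF (before₀ φ)
        (isEmbedding-intro AF AF (before₀ φ) inj hom) onto edge-onto
        where
        inj : Injectiveᵛ (before₀ φ)
        inj i j eq = injφ i j (trans (sym (after₀∘before₀ i)) (trans (cong (lookup φ₀) eq) (after₀∘before₀ j)))
        hom : EdgePreserving AF AF (before₀ φ)
        hom i j ij∈F with image-≡⇒ImageEdge AF φ φ₀ image≡ (i , j , ij∈F , refl , refl)
        ... | k , l , kl∈F , eqk , eql =
          subst₂ (λ u v → AF u v ≡ true) (sym (before₀-unique i k (sym eqk))) (sym (before₀-unique j l (sym eql))) kl∈F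
        onto : ∀ x → x ∈ᵛ before₀ φ
        onto x with image-≡⇒∈ᵛ AF φ₀ φ (sym image≡) (x , refl)
        ... | i , eq = i , before₀-unique i x eq
        edge-onto : ∀ x y → AF x y ≡ true → ImageEdge AF (before₀ φ) x y
        edge-onto x y xy∈F with image-≡⇒ImageEdge AF φ₀ φ (sym image≡) (x , y , xy∈F , refl , refl)
        ... | i , j , ij∈F , eqi , eqj = i , j , ij∈F , before₀-unique i x eqi , before₀-unique j y eqj

    before₀-injective : ∀ φ ψ → sameImage φ ≡ true → sameImage ψ ≡ true → before₀ φ ≡ before₀ ψ → φ ≡ ψ
    before₀-injective φ ψ sameφ sameψ eq = vec-ext λ i →
      trans (sym (after₀∘before₀ φ sameφ i)) (trans (cong (λ v → lookup φ₀ (lookup v i)) eq) (after₀∘before₀ ψ sameψ i))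

  count-sameImage≡#Aut : count f sameImage ≡ #Aut AF
  count-sameImage≡#Aut = ≤-antisym
    (count-≤-injection f sameImage (isAutomorphism AF) before₀ before₀-automorphism before₀-injective)
    (count-≤-injection f (isAutomorphism AF) sameImage after₀ after₀-sameImage after₀-injective)

length-filterᵇ-filterᵇ : ∀ {A : Set} (p q : A → Bool) (xs : List A) →
  length (filterᵇ q (filterᵇ p xs)) ≡ length (filterᵇ (λ x → p x ∧ q x) xs)
length-filterᵇ-filterᵇ p q []       = refl
length-filterᵇ-filterᵇ p q (x ∷ xs) with p x
... | false = length-filterᵇ-filterᵇ p q xs
... | true  with q x
...   | true  = cong suc (length-filterᵇ-filterᵇ p q xs)
...   | false = length-filterᵇ-filterᵇ p q xs

module _ {X Y : Set} (_≟_ : (y y′ : Y) → Dec (y ≡ y′)) (g : X → Y) where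

  ∑ˡ-indicator-unique : ∀ (K : List Y) → Unique K → ∀ {y} → y ∈ K → ∑ˡ K (λ y′ → 𝟙 ⌊ y ≟ y′ ⌋) ≡ 1
  ∑ˡ-indicator-unique (y′ ∷ K) (y′∉K ∷ uniqK) {y} y∈K with y ≟ y′
  ... | yes refl = cong suc (≤-antisym (≤-trans (∑ˡ-bounded K 0 absent) (≤-reflexive (*-zeroʳ (length K)))) z≤n)
    where
    absent : ∀ z → z ∈ K → 𝟙 ⌊ y ≟ z ⌋ ≤ 0
    absent z z∈K = ≤-reflexive (cong 𝟙 (isYes-false⁺ (y ≟ z) (All.lookup y′∉K z∈K)))
  ... | no y≢y′ with y∈K
  ...   | here y≡y′  = contradiction y≡y′ y≢y′
  ...   | there y∈K′ = ∑ˡ-indicator-unique K uniqK y∈K′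

  length≡∑ˡ-fibres : ∀ (K : List Y) → Unique K → (L : List X) → (∀ {x} → x ∈ L → g x ∈ K) →
    length L ≡ ∑ˡ K (λ y → length (filterᵇ (λ x → ⌊ g x ≟ y ⌋) L))
  length≡∑ˡ-fibres K uniqK []      _  = sym (trans (∑ˡ-const K 0) (*-zeroʳ (length K)))
  length≡∑ˡ-fibres K uniqK (x ∷ L) g∈K = begin
    suc (length L)                                                           ≡⟨ cong₂ _+_ (sym (∑ˡ-indicator-unique K uniqK (g∈K (here refl))))
                                                                                          (length≡∑ˡ-fibres K uniqK L (g∈K ∘ there)) ⟩
    ∑ˡ K (λ y → 𝟙 ⌊ g x ≟ y ⌋) + ∑ˡ K (λ y → length (filterᵇ (λ x → ⌊ g x ≟ y ⌋) L)) ≡⟨ sym (∑ˡ-distrib-+ K _ _) ⟩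
    ∑ˡ K (λ y → 𝟙 ⌊ g x ≟ y ⌋ + length (filterᵇ (λ x → ⌊ g x ≟ y ⌋) L))             ≡⟨ ∑ˡ-cong K (λ y _ → length-filterᵇ-∷ y) ⟩
    ∑ˡ K (λ y → length (filterᵇ (λ x → ⌊ g x ≟ y ⌋) (x ∷ L)))                        ∎
    where
    open ≡-Reasoning
    length-filterᵇ-∷ : ∀ y → 𝟙 ⌊ g x ≟ y ⌋ + length (filterᵇ (λ x → ⌊ g x ≟ y ⌋) L) ≡ length (filterᵇ (λ x → ⌊ g x ≟ y ⌋) (x ∷ L))
    length-filterᵇ-∷ y with g x ≟ y
    ... | yes _ = refl
    ... | no  _ = refl

copies*#Aut≡#Emb : ∀ {f n} (F : Graph f) (AG : Adj n) → copies F AG * #Aut (adj F) ≡ #Emb (adj F) AG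
copies*#Aut≡#Emb {f} {n} F AG = sym (begin
  #Emb AF AG                                                           ≡⟨ sym (length-filterᵇ-allVecs f (isEmbedding AF AG)) ⟩
  length embeddings                                                    ≡⟨ length≡∑ˡ-fibres ≟Rep (image AF) images (deduplicate-! ≟Rep _) embeddings
                                                                            (∈-deduplicate⁺ ≟Rep ∘ ∈-map⁺ (image AF)) ⟩
  ∑ˡ images (λ R → length (filterᵇ (λ φ → ⌊ ≟Rep (image AF φ) R ⌋) embeddings)) ≡⟨ ∑ˡ-cong images fibre≡#Aut ⟩
  ∑ˡ images (λ _ → #Aut AF)                                             ≡⟨ ∑ˡ-const images (#Aut AF) ⟩
  length images * #Aut AF                                              ∎)
  where
  open ≡-Reasoning
  AF = adj F
  embeddings = filterᵇ (isEmbedding AF AG) (allVecs f n)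
  images = deduplicate ≟Rep (map (image AF) embeddings)
  fibre≡#Aut : ∀ R → R ∈ images → length (filterᵇ (λ φ → ⌊ ≟Rep (image AF φ) R ⌋) embeddings) ≡ #Aut AF
  fibre≡#Aut R R∈images with ∈-map⁻ (image AF) (∈-deduplicate⁻ ≟Rep (map (image AF) embeddings) R∈images)
  ... | φ₀ , φ₀∈embeddings , refl = begin
    length (filterᵇ (λ φ → ⌊ ≟Rep (image AF φ) (image AF φ₀) ⌋) embeddings) ≡⟨ length-filterᵇ-filterᵇ _ _ (allVecs f n) ⟩
    length (filterᵇ (sameImage AF AG φ₀ emb₀) (allVecs f n))                 ≡⟨ length-filterᵇ-allVecs f _ ⟩
    count f (sameImage AF AG φ₀ emb₀)                                        ≡⟨ count-sameImage≡#Aut AF AG φ₀ emb₀ ⟩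
    #Aut AF                                                                  ∎
    where
    emb₀ = T⇒≡true (proj₂ (∈-filter⁻ (T? ∘ isEmbedding AF AG) {xs = allVecs f n} φ₀∈embeddings))

-- Embeddings through three prescribed vertices

count≤n^f : ∀ {n} f (P : Vec (Fin n) f → Bool) → count f P ≤ n ^ f
count≤n^f {n} f P = ≤-trans (∑ᵛ-bounded f 1 (𝟙≤1 ∘ P)) (≤-reflexive (*-identityʳ (n ^ f)))

count-none : ∀ {n} f (P : Vec (Fin n) f → Bool) → (∀ φ → P φ ≢ true) → count f P ≡ 0
count-none f P ¬P = ∑ᵛ-zero f (λ φ → cong 𝟙 (≢true⇒≡false (¬P φ)))

private
  ∑-*-bounded : ∀ {n} (t : Fin n → ℕ) (c B : ℕ) → (∀ x → t x * c ≤ B) → ∑ t * c ≤ n * B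
  ∑-*-bounded t c B tc≤B = ≤-trans (≤-reflexive (sym (∑-*ʳ c t))) (∑-bounded B tc≤B)

  ∑-single-*-bounded : ∀ {n} (t : Fin n → ℕ) (u : Fin n) (c B : ℕ) → (∀ x → x ≢ u → t x ≡ 0) → t u * c ≤ B →
    ∑ t * (n * c) ≤ n * B
  ∑-single-*-bounded {n} t u c B t≡0 tuc≤B rewrite ∑-single {g = t} u t≡0 =
    ≤-trans (≤-reflexive (*-CS.x∙yz≈y∙xz (t u) n c)) (*-monoʳ-≤ n tuc≤B)

  0*-≤ : ∀ {m} (c B : ℕ) → m ≡ 0 → m * c ≤ B
  0*-≤ c B refl = z≤n

  head-forced : ∀ {n} f (P : Vec (Fin n) (suc f) → Bool) (u x : Fin n) → x ≢ u →
    (∀ φ → P φ ≡ true → lookup φ zero ≡ u) → count f (P ∘ (x ∷_)) ≡ 0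
  head-forced f P u x x≢u forced = count-none f (P ∘ (x ∷_)) (λ φ Pxφ → x≢u (forced (x ∷ φ) Pxφ))

count-pinned₁ : ∀ {n} f (P : Vec (Fin n) f → Bool) (i : Fin f) (u : Fin n) →
  (∀ φ → P φ ≡ true → lookup φ i ≡ u) → count f P * n ^ 1 ≤ n ^ f
count-pinned₁ {n} (suc f) P zero    u pin = ∑-single-*-bounded _ u 1 (n ^ f) (λ x x≢u → head-forced f P u x x≢u pin)
  (≤-trans (≤-reflexive (*-identityʳ _)) (count≤n^f f (P ∘ (u ∷_))))
count-pinned₁ {n} (suc f) P (suc i) u pin = ∑-*-bounded _ (n ^ 1) (n ^ f) (λ x → count-pinned₁ f (P ∘ (x ∷_)) i u (pin ∘ (x ∷_)))

count-pinned₂ : ∀ {n} f (P : Vec (Fin n) f → Bool) (i j : Fin f) (u v : Fin n) → u ≢ v →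
  (∀ φ → P φ ≡ true → lookup φ i ≡ u × lookup φ j ≡ v) → count f P * n ^ 2 ≤ n ^ f
count-pinned₂ {n} (suc f) P zero zero u v u≢v pin =
  0*-≤ _ _ (count-none (suc f) P (λ φ Pφ → u≢v (trans (sym (proj₁ (pin φ Pφ))) (proj₂ (pin φ Pφ)))))
count-pinned₂ {n} (suc f) P zero (suc j) u v u≢v pin =
  ∑-single-*-bounded _ u (n ^ 1) (n ^ f) (λ x x≢u → head-forced f P u x x≢u (λ φ → proj₁ ∘ pin φ))
    (count-pinned₁ f (P ∘ (u ∷_)) j v (λ φ → proj₂ ∘ pin (u ∷ φ)))
count-pinned₂ {n} (suc f) P (suc i) zero u v u≢v pin =
  ∑-single-*-bounded _ v (n ^ 1) (n ^ f) (λ x x≢v → head-forced f P v x x≢v (λ φ → proj₂ ∘ pin φ))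
    (count-pinned₁ f (P ∘ (v ∷_)) i u (λ φ → proj₁ ∘ pin (v ∷ φ)))
count-pinned₂ {n} (suc f) P (suc i) (suc j) u v u≢v pin =
  ∑-*-bounded _ (n ^ 2) (n ^ f) (λ x → count-pinned₂ f (P ∘ (x ∷_)) i j u v u≢v (pin ∘ (x ∷_)))

count-pinned₃ : ∀ {n} f (P : Vec (Fin n) f → Bool) (i j l : Fin f) (u v w : Fin n) → u ≢ v → u ≢ w → v ≢ w →
  (∀ φ → P φ ≡ true → lookup φ i ≡ u × lookup φ j ≡ v × lookup φ l ≡ w) → count f P * n ^ 3 ≤ n ^ f
count-pinned₃ {n} (suc f) P zero zero l u v w u≢v u≢w v≢w pin =
  0*-≤ _ _ (count-none (suc f) P (λ φ Pφ → u≢v (trans (sym (proj₁ (pin φ Pφ))) (proj₁ (proj₂ (pin φ Pφ))))))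
count-pinned₃ {n} (suc f) P zero (suc j) zero u v w u≢v u≢w v≢w pin =
  0*-≤ _ _ (count-none (suc f) P (λ φ Pφ → u≢w (trans (sym (proj₁ (pin φ Pφ))) (proj₂ (proj₂ (pin φ Pφ))))))
count-pinned₃ {n} (suc f) P (suc i) zero zero u v w u≢v u≢w v≢w pin =
  0*-≤ _ _ (count-none (suc f) P (λ φ Pφ → v≢w (trans (sym (proj₁ (proj₂ (pin φ Pφ)))) (proj₂ (proj₂ (pin φ Pφ))))))
count-pinned₃ {n} (suc f) P zero (suc j) (suc l) u v w u≢v u≢w v≢w pin =
  ∑-single-*-bounded _ u (n ^ 2) (n ^ f) (λ x x≢u → head-forced f P u x x≢u (λ φ → proj₁ ∘ pin φ))
    (count-pinned₂ f (P ∘ (u ∷_)) j l v w v≢w (λ φ → proj₂ ∘ pin (u ∷ φ)))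
count-pinned₃ {n} (suc f) P (suc i) zero (suc l) u v w u≢v u≢w v≢w pin =
  ∑-single-*-bounded _ v (n ^ 2) (n ^ f) (λ x x≢v → head-forced f P v x x≢v (λ φ → proj₁ ∘ proj₂ ∘ pin φ))
    (count-pinned₂ f (P ∘ (v ∷_)) i l u w u≢w (λ φ Pφ → proj₁ (pin (v ∷ φ) Pφ) , proj₂ (proj₂ (pin (v ∷ φ) Pφ))))
count-pinned₃ {n} (suc f) P (suc i) (suc j) zero u v w u≢v u≢w v≢w pin =
  ∑-single-*-bounded _ w (n ^ 2) (n ^ f) (λ x x≢w → head-forced f P w x x≢w (λ φ → proj₂ ∘ proj₂ ∘ pin φ))
    (count-pinned₂ f (P ∘ (w ∷_)) i j u v u≢v (λ φ Pφ → proj₁ (pin (w ∷ φ) Pφ) , proj₁ (proj₂ (pin (w ∷ φ) Pφ))))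
count-pinned₃ {n} (suc f) P (suc i) (suc j) (suc l) u v w u≢v u≢w v≢w pin =
  ∑-*-bounded _ (n ^ 3) (n ^ f) (λ x → count-pinned₃ f (P ∘ (x ∷_)) i j l u v w u≢v u≢w v≢w (pin ∘ (x ∷_)))

count-hits₃ : ∀ {n} f (P : Vec (Fin n) f → Bool) (u v w : Fin n) → u ≢ v → u ≢ w → v ≢ w →
  (∀ φ → P φ ≡ true → u ∈ᵛ φ × v ∈ᵛ φ × w ∈ᵛ φ) → count f P * n ^ 3 ≤ f ^ 3 * n ^ f
count-hits₃ {n} f P u v w u≢v u≢w v≢w hits = begin
  count f P * n ^ 3                                      ≤⟨ *-monoˡ-≤ (n ^ 3) (∑ᵛ-mono-≤ f some-placement) ⟩
  ∑ᵛ f (λ φ → ∑³ (λ i j l → 𝟙 (placed i j l φ))) * n ^ 3 ≡⟨ cong (_* n ^ 3) (∑ᵛ-∑³-comm (λ i j l φ → 𝟙 (placed i j l φ))) ⟩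
  ∑³ (λ i j l → count f (placed i j l)) * n ^ 3          ≡⟨ ∑³-*ʳ (λ i j l → count f (placed i j l)) ⟩
  ∑³ (λ i j l → count f (placed i j l) * n ^ 3)          ≤⟨ ∑-bounded _ (λ i → ∑-bounded _ (λ j → ∑-bounded _ (λ l → pinned i j l))) ⟩
  f * (f * (f * n ^ f))                                  ≡⟨ cube f (n ^ f) ⟩
  f ^ 3 * n ^ f                                          ∎
  where
  open ≤-Reasoning
  ∑³ : (Fin f → Fin f → Fin f → ℕ) → ℕ
  ∑³ g = ∑ (λ i → ∑ (λ j → ∑ (λ l → g i j l)))
  placed : Fin f → Fin f → Fin f → Vec (Fin n) f → Bool
  placed i j l φ = eqF (lookup φ i) u ∧ eqF (lookup φ j) v ∧ eqF (lookup φ l) w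
  some-placement : ∀ φ → 𝟙 (P φ) ≤ ∑³ (λ i j l → 𝟙 (placed i j l φ))
  some-placement φ with P φ in Pφ
  ... | false = z≤n
  ... | true with hits φ Pφ
  ...   | (i , φi≡u) , (j , φj≡v) , (l , φl≡w) =
    ≤-trans (≤-reflexive (cong 𝟙 (sym (cong₂ _∧_ (isYes-true⁺ (_ ≟ᶠ u) φi≡u) (cong₂ _∧_ (isYes-true⁺ (_ ≟ᶠ v) φj≡v) (isYes-true⁺ (_ ≟ᶠ w) φl≡w))))))
            (≤-trans (term≤∑ _ l) (≤-trans (term≤∑ _ j) (term≤∑ _ i)))
  ∑ᵛ-∑³-comm : ∀ (g : Fin f → Fin f → Fin f → Vec (Fin n) f → ℕ) → ∑ᵛ f (λ φ → ∑³ (λ i j l → g i j l φ)) ≡ ∑³ (λ i j l → ∑ᵛ f (g i j l))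
  ∑ᵛ-∑³-comm g = trans (∑ᵛ-∑-comm f (λ i φ → ∑ (λ j → ∑ (λ l → g i j l φ))))
    (sum-cong-≗ λ i → trans (∑ᵛ-∑-comm f (λ j φ → ∑ (λ l → g i j l φ))) (sum-cong-≗ λ j → ∑ᵛ-∑-comm f (g i j)))
  ∑³-*ʳ : ∀ (g : Fin f → Fin f → Fin f → ℕ) → ∑³ g * n ^ 3 ≡ ∑³ (λ i j l → g i j l * n ^ 3)
  ∑³-*ʳ g = sym (trans (sum-cong-≗ λ i → trans (sum-cong-≗ λ j → ∑-*ʳ (n ^ 3) (g i j)) (∑-*ʳ (n ^ 3) (λ j → ∑ (g i j))))
                       (∑-*ʳ (n ^ 3) (λ i → ∑ (λ j → ∑ (g i j)))))
  pinned : ∀ i j l → count f (placed i j l) * n ^ 3 ≤ n ^ f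
  pinned i j l = count-pinned₃ f (placed i j l) i j l u v w u≢v u≢w v≢w λ φ placed≡true →
    isYes-true⁻ (_ ≟ᶠ u) (Boolₚ.∧-conicalˡ _ _ placed≡true) ,
    isYes-true⁻ (_ ≟ᶠ v) (Boolₚ.∧-conicalˡ _ _ (Boolₚ.∧-conicalʳ (eqF (lookup φ i) u) _ placed≡true)) ,
    isYes-true⁻ (_ ≟ᶠ w) (Boolₚ.∧-conicalʳ (eqF (lookup φ j) v) _ (Boolₚ.∧-conicalʳ (eqF (lookup φ i) u) _ placed≡true))
  cube : ∀ a b → a * (a * (a * b)) ≡ a ^ 3 * b
  cube = solve 2 (λ a b → a :* (a :* (a :* b)) := (a :* (a :* (a :* con 1))) :* b) refl

monochromatic-edge : ∀ {f} (AF : Adj f) (r : ℕ) → ¬ Colorable AF r → (c : Fin f → Fin r) →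
  ∃[ i ] ∃[ j ] AF i j ≡ true × c i ≡ c j
monochromatic-edge AF r ¬col c with Finₚ.any? (λ i → Finₚ.any? (λ j → (AF i j Boolₚ.≟ true) ×-dec (c i ≟ᶠ c j)))
... | yes (i , j , ij∈F , ci≡cj) = i , j , ij∈F , ci≡cj
... | no  none                   = contradiction (c , λ u v uv∈F cu≡cv → none (u , v , uv∈F , cu≡cv)) ¬col

isPair⁻ : ∀ {n} (a b u v : Fin n) → isPair a b u v ≡ true → (u ≡ a × v ≡ b) ⊎ (u ≡ b × v ≡ a)
isPair⁻ a b u v uv≡ab with ∨-true⁻ (eqF u a ∧ eqF v b) uv≡ab
... | inj₁ h = inj₁ (isYes-true⁻ (u ≟ᶠ a) (Boolₚ.∧-conicalˡ _ _ h) , isYes-true⁻ (v ≟ᶠ b) (Boolₚ.∧-conicalʳ (eqF u a) _ h))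
... | inj₂ h = inj₂ (isYes-true⁻ (u ≟ᶠ b) (Boolₚ.∧-conicalˡ _ _ h) , isYes-true⁻ (v ≟ᶠ a) (Boolₚ.∧-conicalʳ (eqF u b) _ h))

isPair⁺ˡ : ∀ {n} (a b : Fin n) → isPair a b a b ≡ true
isPair⁺ˡ a b rewrite eqF-refl a | eqF-refl b = refl

isPair⁺ʳ : ∀ {n} (a b : Fin n) → isPair a b b a ≡ true
isPair⁺ʳ a b rewrite eqF-refl a | eqF-refl b = Boolₚ.∨-zeroʳ _

K⁺ : ∀ {n r} → (Fin n → Fin r) → Fin n → Fin n → Adj n
K⁺ q a b = addEdge (completePartite q) a b

module _ {f n r : ℕ} (AF : Adj f) (¬col : ¬ Colorable AF r) (q : Fin n → Fin r) (a b : Fin n) (φ : Vec (Fin n) f)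
         (emb : isEmbedding AF (K⁺ q a b) φ ≡ true) where

  embedding-uses-added-edge : ∃[ i ] ∃[ j ] AF i j ≡ true × isPair a b (lookup φ i) (lookup φ j) ≡ true
  embedding-uses-added-edge with monochromatic-edge AF r ¬col (q ∘ lookup φ)
  ... | i , j , ij∈F , same-part = i , j , ij∈F , added (isEmbedding⇒edge-preserving AF (K⁺ q a b) φ emb i j ij∈F)
    where
    added : not (eqF (q (lookup φ i)) (q (lookup φ j))) ∨ isPair a b (lookup φ i) (lookup φ j) ≡ true →
            isPair a b (lookup φ i) (lookup φ j) ≡ true
    added h rewrite same-part | eqF-refl (q (lookup φ j)) = h

  embedding-covers-added-edge : a ∈ᵛ φ × b ∈ᵛ φ
  embedding-covers-added-edge with embedding-uses-added-edge
  ... | i , j , _ , ij↦ab with isPair⁻ a b (lookup φ i) (lookup φ j) ij↦ab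
  ...   | inj₁ (φi≡a , φj≡b) = (i , φi≡a) , (j , φj≡b)
  ...   | inj₂ (φi≡b , φj≡a) = (j , φj≡a) , (i , φi≡b)

transpose-matchˡ : ∀ {n} (i j : Fin n) → transpose i j i ≡ j
transpose-matchˡ i j with i ≟ᶠ i
... | yes _  = refl
... | no i≢i = contradiction refl i≢i

transpose-matchʳ : ∀ {n} (i j : Fin n) → transpose i j j ≡ i
transpose-matchʳ i j with j ≟ᶠ i
... | yes j≡i = j≡i
... | no _ with j ≟ᶠ j
...   | yes _  = refl
...   | no j≢j = contradiction refl j≢j

transpose-other : ∀ {n} (i j k : Fin n) → k ≢ i → k ≢ j → transpose i j k ≡ k
transpose-other i j k k≢i k≢j with k ≟ᶠ i
... | yes k≡i = contradiction k≡i k≢i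
... | no _ with k ≟ᶠ j
...   | yes k≡j = contradiction k≡j k≢j
...   | no _    = refl

transpose-involutive : ∀ {n} (i j k : Fin n) → transpose i j (transpose i j k) ≡ k
transpose-involutive i j k with k ≟ᶠ i
... | yes refl = transpose-matchʳ k j
... | no k≢i with k ≟ᶠ j
...   | yes refl = transpose-matchˡ i k
...   | no k≢j   = transpose-other i j k k≢i k≢j

eqF-injective : ∀ {n m} (τ : Fin n → Fin m) → (∀ x y → τ x ≡ τ y → x ≡ y) → ∀ x y → eqF (τ x) (τ y) ≡ eqF x y
eqF-injective τ τ-inj x y = ⇔-true⇒≡ (isYes-true⁺ (x ≟ᶠ y) ∘ τ-inj x y ∘ isYes-true⁻ (τ x ≟ᶠ τ y))
                                     (isYes-true⁺ (τ x ≟ᶠ τ y) ∘ cong τ ∘ isYes-true⁻ (x ≟ᶠ y))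

module _ {n : ℕ} (σ : Fin n → Fin n) (σσ : ∀ i → σ (σ i) ≡ i) where

  involution-injective : ∀ x y → σ x ≡ σ y → x ≡ y
  involution-injective x y σx≡σy = trans (sym (σσ x)) (trans (cong σ σx≡σy) (σσ y))

  eqF-involution : ∀ u a → eqF (σ u) a ≡ eqF u (σ a)
  eqF-involution u a = ⇔-true⇒≡ (isYes-true⁺ (u ≟ᶠ σ a) ∘ (λ σu≡a → trans (sym (σσ u)) (cong σ σu≡a)) ∘ isYes-true⁻ (σ u ≟ᶠ a))
                                (isYes-true⁺ (σ u ≟ᶠ a) ∘ (λ u≡σa → trans (cong σ u≡σa) (σσ a)) ∘ isYes-true⁻ (u ≟ᶠ σ a))

  isPair-involution : ∀ a b u v → isPair a b (σ u) (σ v) ≡ isPair (σ a) (σ b) u v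
  isPair-involution a b u v
    rewrite eqF-involution u a | eqF-involution v b | eqF-involution u b | eqF-involution v a = refl

  #Emb-involution : ∀ {f} (AF : Adj f) (AG : Adj n) → #Emb AF (λ u v → AG (σ u) (σ v)) ≡ #Emb AF AG
  #Emb-involution {f} AF AG =
    trans (∑ᵛ-cong f (cong 𝟙 ∘ relabel)) (∑ᵛ-permute-involution f σ σσ (𝟙 ∘ isEmbedding AF AG))
    where
    AGσ : Adj n
    AGσ u v = AG (σ u) (σ v)
    lookup-σ : ∀ φ i → lookup (Data.Vec.map σ φ) i ≡ σ (lookup φ i)
    lookup-σ φ i = Vecₚ.lookup-map i σ φ
    relabel : ∀ φ → isEmbedding AF AGσ φ ≡ isEmbedding AF AG (Data.Vec.map σ φ)
    relabel φ = ⇔-true⇒≡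
      (λ emb → isEmbedding-intro AF AG (Data.Vec.map σ φ)
        (λ i j eq → isEmbedding⇒injective AF AGσ φ emb i j
                      (involution-injective _ _ (trans (sym (lookup-σ φ i)) (trans eq (lookup-σ φ j)))))
        (λ i j ij∈F → subst₂ (λ u v → AG u v ≡ true) (sym (lookup-σ φ i)) (sym (lookup-σ φ j))
                        (isEmbedding⇒edge-preserving AF AGσ φ emb i j ij∈F)))
      (λ emb → isEmbedding-intro AF AGσ φ
        (λ i j eq → isEmbedding⇒injective AF AG (Data.Vec.map σ φ) emb i j
                      (trans (lookup-σ φ i) (trans (cong σ eq) (sym (lookup-σ φ j)))))
        (λ i j ij∈F → subst₂ (λ u v → AG u v ≡ true) (lookup-σ φ i) (lookup-σ φ j)
                        (isEmbedding⇒edge-preserving AF AG (Data.Vec.map σ φ) emb i j ij∈F)))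

  #Emb-K⁺-permute : ∀ {f r} (AF : Adj f) (q : Fin n → Fin r) (a b : Fin n) →
    #Emb AF (K⁺ (q ∘ σ) (σ a) (σ b)) ≡ #Emb AF (K⁺ q a b)
  #Emb-K⁺-permute AF q a b =
    trans (#Emb-cong AF (λ u v → cong (not (eqF (q (σ u)) (q (σ v))) ∨_) (sym (isPair-involution a b u v))))
          (#Emb-involution AF (K⁺ q a b))

#Emb-K⁺-cong : ∀ {f n r} (AF : Adj f) {q q′ : Fin n → Fin r} (a b : Fin n) → (∀ v → q v ≡ q′ v) →
  #Emb AF (K⁺ q a b) ≡ #Emb AF (K⁺ q′ a b)
#Emb-K⁺-cong AF a b q≗q′ = #Emb-cong AF (λ u v → cong₂ (λ x y → not (eqF x y) ∨ isPair a b u v) (q≗q′ u) (q≗q′ v))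

#Emb-K⁺-relabel : ∀ {f n r} (AF : Adj f) (q : Fin n → Fin r) (a b : Fin n) (τ : Fin r → Fin r) →
  (∀ i → τ (τ i) ≡ i) → #Emb AF (K⁺ (τ ∘ q) a b) ≡ #Emb AF (K⁺ q a b)
#Emb-K⁺-relabel AF q a b τ ττ =
  #Emb-cong AF (λ u v → cong (λ z → not z ∨ isPair a b u v) (eqF-injective τ (involution-injective τ ττ) (q u) (q v)))

#Emb-K⁺-move : ∀ {f n r} (AF : Adj f) → ¬ Colorable AF r → (q q′ : Fin n → Fin r) (a b w : Fin n) →
  a ≢ b → w ≢ a → w ≢ b → (∀ v → v ≢ w → q v ≡ q′ v) →
  #Emb AF (K⁺ q a b) * n ^ 3 ≤ #Emb AF (K⁺ q′ a b) * n ^ 3 + f ^ 3 * n ^ f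
#Emb-K⁺-move {f} {n} AF ¬col q q′ a b w a≢b w≢a w≢b q≗q′ = begin
  #Emb AF (K⁺ q a b) * n ^ 3                                  ≤⟨ *-monoˡ-≤ (n ^ 3) (∑ᵛ-mono-≤ f split) ⟩
  ∑ᵛ f (λ φ → 𝟙 (isEmbedding AF (K⁺ q′ a b) φ) + 𝟙 (covers-w φ)) * n ^ 3
                                                              ≡⟨ cong (_* n ^ 3) (∑ᵛ-distrib-+ f _ _) ⟩
  (#Emb AF (K⁺ q′ a b) + count f covers-w) * n ^ 3            ≡⟨ *-distribʳ-+ (n ^ 3) (#Emb AF (K⁺ q′ a b)) _ ⟩
  #Emb AF (K⁺ q′ a b) * n ^ 3 + count f covers-w * n ^ 3      ≤⟨ +-monoʳ-≤ _ (count-hits₃ f covers-w a b w a≢b (w≢a ∘ sym) (w≢b ∘ sym) hits) ⟩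
  #Emb AF (K⁺ q′ a b) * n ^ 3 + f ^ 3 * n ^ f                 ∎
  where
  open ≤-Reasoning
  covers-w : Vec (Fin n) f → Bool
  covers-w φ = isEmbedding AF (K⁺ q a b) φ ∧ ⌊ w ∈ᵛ? φ ⌋
  hits : ∀ φ → covers-w φ ≡ true → a ∈ᵛ φ × b ∈ᵛ φ × w ∈ᵛ φ
  hits φ cov with embedding-covers-added-edge AF ¬col q a b φ (Boolₚ.∧-conicalˡ _ _ cov)
  ... | a∈φ , b∈φ = a∈φ , b∈φ , isYes-true⁻ (w ∈ᵛ? φ) (Boolₚ.∧-conicalʳ (isEmbedding AF (K⁺ q a b) φ) _ cov)
  split : ∀ φ → 𝟙 (isEmbedding AF (K⁺ q a b) φ) ≤ 𝟙 (isEmbedding AF (K⁺ q′ a b) φ) + 𝟙 (covers-w φ)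
  split φ with isEmbedding AF (K⁺ q a b) φ in emb
  ... | false = z≤n
  ... | true with w ∈ᵛ? φ
  ...   | yes _   = m≤n+m 1 _
  ...   | no  w∉φ = ≤-trans (≤-reflexive (cong 𝟙 (sym emb′))) (m≤m+n _ _)
    where
    unmoved : ∀ i → q (lookup φ i) ≡ q′ (lookup φ i)
    unmoved i = q≗q′ (lookup φ i) (λ φi≡w → w∉φ (i , φi≡w))
    emb′ : isEmbedding AF (K⁺ q′ a b) φ ≡ true
    emb′ = isEmbedding-intro AF (K⁺ q′ a b) φ (isEmbedding⇒injective AF (K⁺ q a b) φ emb)
      (λ i j ij∈F → subst₂ (λ x y → not (eqF x y) ∨ isPair a b (lookup φ i) (lookup φ j) ≡ true) (unmoved i) (unmoved j)
                      (isEmbedding⇒edge-preserving AF (K⁺ q a b) φ emb i j ij∈F))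

-- Comparing partitions through their part sizes

size : ∀ {n r} → (Fin n → Fin r) → Fin r → ℕ
size q k = ∑ (λ v → 𝟙 (eqF (q v) k))

partSize≡size : ∀ {n r} (q : Fin n → Fin r) k → partSize q k ≡ size q k
partSize≡size {n} q k = trans (length-filterᵇ _ (allFin n)) (∑ˡ-tabulate {n} (λ v → v) (λ v → 𝟙 (eqF (q v) k)))

∑-size : ∀ {n r} (q : Fin n → Fin r) → ∑ (size q) ≡ n
∑-size {n} {r} q = begin
  ∑ (λ k → ∑ (λ v → 𝟙 (eqF (q v) k)))  ≡⟨ ∑-comm {r} {n} _ ⟩
  ∑ (λ v → ∑ (λ k → 𝟙 (eqF (q v) k)))  ≡⟨ sum-cong-≗ (λ v → trans (∑-single (q v) (λ k k≢qv → cong 𝟙 (isYes-false⁺ (q v ≟ᶠ k) (k≢qv ∘ sym))))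
                                                                     (cong 𝟙 (eqF-refl (q v)))) ⟩
  ∑ {n} (λ _ → 1)                       ≡⟨ ∑-const n ⟩
  n                                     ∎
  where open ≡-Reasoning

size-permute : ∀ {n r} (q : Fin n → Fin r) (σ : Fin n → Fin n) → (∀ i → σ (σ i) ≡ i) → ∀ k → size (q ∘ σ) k ≡ size q k
size-permute q σ σσ k = ∑-permute-involution σ σσ (λ v → 𝟙 (eqF (q v) k))

size-relabel : ∀ {n r} (q : Fin n → Fin r) (τ : Fin r → Fin r) → (∀ i → τ (τ i) ≡ i) → ∀ k → size (τ ∘ q) k ≡ size q (τ k)
size-relabel q τ ττ k = sum-cong-≗ (λ v → cong 𝟙 (eqF-involution τ ττ (q v) k))

moveTo : ∀ {n r} → (Fin n → Fin r) → Fin n → Fin r → Fin n → Fin r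
moveTo q w k = updateAt q w (λ _ → k)

module _ {n r : ℕ} (q : Fin n → Fin r) (w : Fin n) (k : Fin r) (qw≢k : q w ≢ k) where

  private
    q′ = moveTo q w k

    size-moveTo : ∀ l → size q′ l + 𝟙 (eqF (q w) l) ≡ size q l + 𝟙 (eqF k l)
    size-moveTo l = trans (∑-update w (λ v v≢w → cong (λ x → 𝟙 (eqF x l)) (updateAt-minimal v w q v≢w)))
                          (cong (λ x → size q l + 𝟙 (eqF x l)) (updateAt-updates w q))

  size-moveTo-target : size (moveTo q w k) k ≡ suc (size q k)
  size-moveTo-target = begin
    size q′ k                        ≡⟨ +-identityʳ _ ⟨
    size q′ k + 0                    ≡⟨ cong (λ x → size q′ k + 𝟙 x) (isYes-false⁺ (q w ≟ᶠ k) qw≢k) ⟨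
    size q′ k + 𝟙 (eqF (q w) k)      ≡⟨ size-moveTo k ⟩
    size q k + 𝟙 (eqF k k)           ≡⟨ cong (λ x → size q k + 𝟙 x) (eqF-refl k) ⟩
    size q k + 1                     ≡⟨ +-comm (size q k) 1 ⟩
    suc (size q k)                   ∎
    where open ≡-Reasoning

  size-moveTo-source : size q (q w) ≡ suc (size (moveTo q w k) (q w))
  size-moveTo-source = begin
    size q (q w)                     ≡⟨ +-identityʳ _ ⟨
    size q (q w) + 0                 ≡⟨ cong (λ x → size q (q w) + 𝟙 x) (isYes-false⁺ (k ≟ᶠ q w) (qw≢k ∘ sym)) ⟨
    size q (q w) + 𝟙 (eqF k (q w))   ≡⟨ size-moveTo (q w) ⟨
    size q′ (q w) + 𝟙 (eqF (q w) (q w)) ≡⟨ cong (λ x → size q′ (q w) + 𝟙 x) (eqF-refl (q w)) ⟩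
    size q′ (q w) + 1                ≡⟨ +-comm (size q′ (q w)) 1 ⟩
    suc (size q′ (q w))              ∎
    where open ≡-Reasoning

  size-moveTo-other : ∀ l → l ≢ k → l ≢ q w → size (moveTo q w k) l ≡ size q l
  size-moveTo-other l l≢k l≢qw = begin
    size q′ l                        ≡⟨ +-identityʳ _ ⟨
    size q′ l + 0                    ≡⟨ cong (λ x → size q′ l + 𝟙 x) (isYes-false⁺ (q w ≟ᶠ l) (l≢qw ∘ sym)) ⟨
    size q′ l + 𝟙 (eqF (q w) l)      ≡⟨ size-moveTo l ⟩
    size q l + 𝟙 (eqF k l)           ≡⟨ cong (λ x → size q l + 𝟙 x) (isYes-false⁺ (k ≟ᶠ l) (l≢k ∘ sym)) ⟩
    size q l + 0                     ≡⟨ +-identityʳ _ ⟩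
    size q l                         ∎
    where open ≡-Reasoning

mismatches : ∀ {n r} → (Fin n → Fin r) → (Fin n → Fin r) → ℕ
mismatches p q = ∑ (λ v → 𝟙 (not (eqF (p v) (q v))))

sizeDistance : ∀ {n r} → (Fin n → Fin r) → (Fin n → Fin r) → ℕ
sizeDistance p q = ∑ (λ k → ∣ size p k - size q k ∣)

module _ {n r : ℕ} (p q : Fin n → Fin r) where

  private
    mismatch : Fin n → ℕ
    mismatch v = 𝟙 (not (eqF (p v) (q v)))

    mismatch-≢ : ∀ v → p v ≢ q v → mismatch v ≡ 1
    mismatch-≢ v pv≢qv = cong (𝟙 ∘ not) (isYes-false⁺ (p v ≟ᶠ q v) pv≢qv)

    mismatch-≡ : ∀ {v} {x} → p v ≡ x → 𝟙 (not (eqF (p v) x)) ≡ 0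
    mismatch-≡ {v} pv≡x = cong (𝟙 ∘ not) (isYes-true⁺ (p v ≟ᶠ _) pv≡x)

  mismatches-transpose : ∀ u v → p u ≢ q u → p v ≢ q v → q v ≡ p u → mismatches p (q ∘ transpose u v) < mismatches p q
  mismatches-transpose u v pu≢qu pv≢qv qv≡pu = ∑-mono-< u no-new-mismatch fixed-u
    where
    fixed-u : 𝟙 (not (eqF (p u) (q (transpose u v u)))) < mismatch u
    fixed-u rewrite transpose-matchˡ u v | mismatch-≡ (sym qv≡pu) | mismatch-≢ u pu≢qu = s≤s z≤n
    no-new-mismatch : ∀ x → 𝟙 (not (eqF (p x) (q (transpose u v x)))) ≤ mismatch x
    no-new-mismatch x = by-cases (x ≟ᶠ u) (x ≟ᶠ v)
      where
      by-cases : Dec (x ≡ u) → Dec (x ≡ v) → 𝟙 (not (eqF (p x) (q (transpose u v x)))) ≤ mismatch x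
      by-cases (yes refl) _          = ≤-trans (𝟙≤1 _) (≤-reflexive (sym (mismatch-≢ x pu≢qu)))
      by-cases (no _)     (yes refl) = ≤-trans (𝟙≤1 _) (≤-reflexive (sym (mismatch-≢ x pv≢qv)))
      by-cases (no x≢u)   (no x≢v)   = ≤-reflexive (cong (λ y → 𝟙 (not (eqF (p x) (q y)))) (transpose-other u v x x≢u x≢v))

  mismatches-moveTo : ∀ w → p w ≢ q w → mismatches p (moveTo q w (p w)) < mismatches p q
  mismatches-moveTo w pw≢qw = ∑-mono-< w no-new-mismatch fixed-w
    where
    fixed-w : 𝟙 (not (eqF (p w) (moveTo q w (p w) w))) < mismatch w
    fixed-w rewrite updateAt-updates w {λ _ → p w} q | mismatch-≡ {w} refl | mismatch-≢ w pw≢qw = s≤s z≤n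
    no-new-mismatch : ∀ x → 𝟙 (not (eqF (p x) (moveTo q w (p w) x))) ≤ mismatch x
    no-new-mismatch x with x ≟ᶠ w
    ... | yes refl = ≤-trans (𝟙≤1 _) (≤-reflexive (sym (mismatch-≢ x pw≢qw)))
    ... | no x≢w   = ≤-reflexive (cong (λ y → 𝟙 (not (eqF (p x) y))) (updateAt-minimal x w q x≢w))

compensating-witness : ∀ {n} (P Q : Fin n → Bool) (w : Fin n) → ∑ (𝟙 ∘ P) ≤ ∑ (𝟙 ∘ Q) → P w ≡ true → Q w ≡ false →
  ∃[ w′ ] Q w′ ≡ true × P w′ ≡ false
compensating-witness P Q w ∑P≤∑Q Pw ¬Qw with Finₚ.any? (λ y → (Q y Boolₚ.≟ true) ×-dec (P y Boolₚ.≟ false))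
... | yes witness = witness
... | no  none    = contradiction ∑P≤∑Q (<⇒≱ (∑-mono-< w Q≤P Qw<Pw))
  where
  Q≤P : ∀ y → 𝟙 (Q y) ≤ 𝟙 (P y)
  Q≤P y with Q y in Qy | P y in Py
  ... | false | _     = z≤n
  ... | true  | true  = ≤-refl
  ... | true  | false = contradiction (y , Qy , Py) none
  Qw<Pw : 𝟙 (Q w) < 𝟙 (P w)
  Qw<Pw rewrite Pw | ¬Qw = s≤s z≤n

module _ {f n r : ℕ} (AF : Adj f) (¬col : ¬ Colorable AF r) (a b : Fin n) (a≢b : a ≢ b) where

  private
    M : ℕ
    M = f ^ 3 * n ^ f

    E³ : (Fin n → Fin r) → ℕ
    E³ q = #Emb AF (K⁺ q a b) * n ^ 3

  -- Induction on the number of vertices where q disagrees with p.  A mismatched vertex w is either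
  -- swapped with a vertex that compensates it (the count is unchanged up to isomorphism), or, if
  -- there is none, moved to the part p w, which lowers the size distance by at least one.
  #Emb-K⁺-sizeDistance : ∀ (p q : Fin n → Fin r) → q a ≡ p a → q b ≡ p b →
    #Emb AF (K⁺ p a b) * n ^ 3 ≈[ sizeDistance p q * (f ^ 3 * n ^ f) ] #Emb AF (K⁺ q a b) * n ^ 3
  #Emb-K⁺-sizeDistance p q = go q (<-wellFounded (mismatches p q))
    where
    go : ∀ q → Acc _<_ (mismatches p q) → q a ≡ p a → q b ≡ p b → E³ p ≈[ sizeDistance p q * M ] E³ q
    go q (acc smaller) qa≡pa qb≡pb with Finₚ.any? (λ w → ¬? (p w ≟ᶠ q w))
    ... | no all-match =
      subst (λ e → E³ p ≈[ _ ] e * n ^ 3) (#Emb-K⁺-cong AF a b (λ v → decidable-stable (p v ≟ᶠ q v) (all-match ∘ (v ,_)))) (≈-refl _)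
    ... | yes (w , pw≢qw) = step
      where
      matched-≢ : ∀ {x} → p x ≢ q x → ∀ {y} → q y ≡ p y → x ≢ y
      matched-≢ px≢qx qy≡py refl = px≢qx (sym qy≡py)

      swap : ∀ u v → p u ≢ q u → p v ≢ q v → q v ≡ p u → E³ p ≈[ sizeDistance p q * M ] E³ q
      swap u v pu≢qu pv≢qv qv≡pu =
        subst₂ (λ d e → E³ p ≈[ d * M ] e * n ^ 3) same-distance same-count
          (go (q ∘ σ) (smaller (mismatches-transpose p q u v pu≢qu pv≢qv qv≡pu))
              (trans (cong q σa≡a) qa≡pa) (trans (cong q σb≡b) qb≡pb))
        where
        σ = transpose u v
        σa≡a = transpose-other u v a (matched-≢ pu≢qu qa≡pa ∘ sym) (matched-≢ pv≢qv qa≡pa ∘ sym)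
        σb≡b = transpose-other u v b (matched-≢ pu≢qu qb≡pb ∘ sym) (matched-≢ pv≢qv qb≡pb ∘ sym)
        same-count : #Emb AF (K⁺ (q ∘ σ) a b) ≡ #Emb AF (K⁺ q a b)
        same-count = trans (cong₂ (λ x y → #Emb AF (K⁺ (q ∘ σ) x y)) (sym σa≡a) (sym σb≡b))
                           (#Emb-K⁺-permute σ (transpose-involutive u v) AF q a b)
        same-distance : sizeDistance p (q ∘ σ) ≡ sizeDistance p q
        same-distance = sum-cong-≗ (λ k → cong (λ s → ∣ size p k - s ∣) (size-permute q σ (transpose-involutive u v) k))

      move : size q (p w) < size p (p w) → size p (q w) < size q (q w) → E³ p ≈[ sizeDistance p q * M ] E³ q
      move q<p p<q = ≈-weaken (≤-trans (≤-reflexive (+-comm (sizeDistance p q′ * M) M)) (*-monoˡ-≤ M closer))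
        (≈-trans (go q′ (smaller (mismatches-moveTo p q w pw≢qw)) (moved-fixes qa≡pa) (moved-fixes qb≡pb))
                 (#Emb-K⁺-move AF ¬col q′ q a b w a≢b wa wb (λ v v≢w → updateAt-minimal v w q v≢w) ,
                  #Emb-K⁺-move AF ¬col q q′ a b w a≢b wa wb (λ v v≢w → sym (updateAt-minimal v w q v≢w))))
        where
        k = p w
        q′ = moveTo q w k
        wa = matched-≢ pw≢qw qa≡pa
        wb = matched-≢ pw≢qw qb≡pb
        moved-fixes : ∀ {x} → q x ≡ p x → q′ x ≡ p x
        moved-fixes {x} qx≡px = trans (updateAt-minimal x w q (λ x≡w → matched-≢ pw≢qw qx≡px (sym x≡w))) qx≡px
        closer-at-k : ∣ size p k - size q′ k ∣ < ∣ size p k - size q k ∣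
        closer-at-k rewrite size-moveTo-target q w k (pw≢qw ∘ sym) = ∣-∣-suc-< (size p k) (size q k) q<p
        no-further : ∀ l → ∣ size p l - size q′ l ∣ ≤ ∣ size p l - size q l ∣
        no-further l with l ≟ᶠ k | l ≟ᶠ q w
        ... | yes refl | _        = <⇒≤ closer-at-k
        ... | no _     | yes refl = subst (λ s → ∣ size p l - size q′ l ∣ ≤ ∣ size p l - s ∣) (sym source)
          (<⇒≤ (∣-∣-suc-> (size p l) (size q′ l) (≤-pred (subst (size p l <_) source p<q))))
          where source = size-moveTo-source q w k (pw≢qw ∘ sym)
        ... | no l≢k   | no l≢qw  = ≤-reflexive (cong (λ s → ∣ size p l - s ∣) (size-moveTo-other q w k (pw≢qw ∘ sym) l l≢k l≢qw))
        closer : suc (sizeDistance p q′) ≤ sizeDistance p q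
        closer = ∑-mono-< k no-further closer-at-k

      step : E³ p ≈[ sizeDistance p q * M ] E³ q
      step with size p (p w) ≤? size q (p w)
      ... | yes p≤q with compensating-witness (λ v → eqF (p v) (p w)) (λ v → eqF (q v) (p w)) w p≤q
                           (eqF-refl (p w)) (isYes-false⁺ (q w ≟ᶠ p w) (pw≢qw ∘ sym))
      ...   | w′ , qw′≡pw , pw′≢pw = swap w w′ pw≢qw
              (λ pw′≡qw′ → isYes-false⁻ (p w′ ≟ᶠ p w) pw′≢pw (trans pw′≡qw′ (isYes-true⁻ (q w′ ≟ᶠ p w) qw′≡pw)))
              (isYes-true⁻ (q w′ ≟ᶠ p w) qw′≡pw)
      step | no p≰q with size q (q w) ≤? size p (q w)
      ... | yes q≤p with compensating-witness (λ v → eqF (q v) (q w)) (λ v → eqF (p v) (q w)) w q≤p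
                           (eqF-refl (q w)) (isYes-false⁺ (p w ≟ᶠ q w) pw≢qw)
      ...   | w′ , pw′≡qw , qw′≢qw = swap w′ w
              (λ pw′≡qw′ → isYes-false⁻ (q w′ ≟ᶠ q w) qw′≢qw (trans (sym pw′≡qw′) (isYes-true⁻ (p w′ ≟ᶠ q w) pw′≡qw)))
              pw≢qw (sym (isYes-true⁻ (p w′ ≟ᶠ q w) pw′≡qw))
      step | no p≰q | no q≰p = move (≰⇒> p≰q) (≰⇒> q≰p)

spread-bounds-size : ∀ {n r} (p : Fin n → Fin r) k l → size p k ≤ size p l + spread p
spread-bounds-size {n} {r} p k l = begin
  size p k                 ≡⟨ partSize≡size p k ⟨
  partSize p k             ≤⟨ ⊔-bound (∈-map⁺ (partSize p) (∈-allFin k)) ⟩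
  largest                  ≤⟨ m≤n+m∸n largest smallest ⟩
  smallest + spread p      ≤⟨ +-monoˡ-≤ (spread p) (⊓-bound (∈-map⁺ (partSize p) (∈-allFin l))) ⟩
  partSize p l + spread p  ≡⟨ cong (_+ spread p) (partSize≡size p l) ⟩
  size p l + spread p      ∎
  where
  open ≤-Reasoning
  sizes = map (partSize p) (allFin r)
  largest = foldr _⊔_ 0 sizes
  smallest = foldr _⊓_ n sizes
  ⊔-bound : ∀ {x xs} → x ∈ xs → x ≤ foldr _⊔_ 0 xs
  ⊔-bound {x} (here refl) = m≤m⊔n x _
  ⊔-bound {xs = y ∷ _} (there x∈xs) = ≤-trans (⊔-bound x∈xs) (m≤n⊔m y _)
  ⊓-bound : ∀ {x xs} → x ∈ xs → foldr _⊓_ n xs ≤ x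
  ⊓-bound {x} (here refl) = m⊓n≤m x _
  ⊓-bound {xs = y ∷ _} (there x∈xs) = ≤-trans (m⊓n≤n y _) (⊓-bound x∈xs)

nearly-equal-sums : ∀ {r} (P Q : Fin r → ℕ) (s t : ℕ) → (∀ k l → P k ≤ P l + s) → (∀ k l → Q k ≤ Q l + t) →
  ∑ P ≤ ∑ Q → ∀ k → P k ≤ Q k + (s + t)
nearly-equal-sums P Q s t P-spread Q-spread ∑P≤∑Q k with P k ≤? Q k + (s + t)
... | yes Pk≤ = Pk≤
... | no  Pk≰ = contradiction ∑P≤∑Q (<⇒≱ (∑-mono-< k (<⇒≤ ∘ Q<P) (Q<P k)))
  where
  Q<P : ∀ l → Q l < P l
  Q<P l = +-cancelʳ-≤ s (suc (Q l)) (P l) (begin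
    suc (Q l) + s      ≤⟨ +-monoˡ-≤ s (s≤s (Q-spread l k)) ⟩
    suc (Q k + t) + s  ≡⟨ cong suc (trans (+-assoc (Q k) t s) (cong (Q k +_) (+-comm t s))) ⟩
    suc (Q k + (s + t)) ≤⟨ ≰⇒> Pk≰ ⟩
    P k                ≤⟨ P-spread k l ⟩
    P l + s            ∎)
    where open ≤-Reasoning

sizeDistance-bound : ∀ {n r} (p q : Fin n → Fin r) → (∀ k l → size q k ≤ size q l + 1) →
  sizeDistance p q ≤ r * suc (spread p)
sizeDistance-bound {n} {r} p q q-balanced = ∑-bounded (suc s) λ k → ≈⇒∣-∣≤
  (subst (λ c → size p k ≤ size q k + c) (+-comm s 1)
         (nearly-equal-sums (size p) (size q) s 1 (spread-bounds-size p) q-balanced (≤-reflexive same-total) k) ,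
   nearly-equal-sums (size q) (size p) 1 s q-balanced (spread-bounds-size p) (≤-reflexive (sym same-total)) k)
  where
  s = spread p
  same-total : ∑ (size p) ≡ ∑ (size q)
  same-total = trans (∑-size p) (sym (∑-size q))

-- Transport p* along the transpositions a ↔ a* and b ↔ σ₁ b*, then swap two part labels so
-- that the result agrees with p on a and b.
K⁺-balanced-copy : ∀ {f n r} (AF : Adj f) (p : Fin n → Fin r) (a b : Fin n) → a ≢ b → p a ≡ p b →
  (p* : Fin n → Fin r) → Balanced p* → (a* b* : Fin n) → a* ≢ b* → p* a* ≡ p* b* →
  ∃[ q ] (∀ k l → size q k ≤ size q l + 1) × q a ≡ p a × q b ≡ p b × #Emb AF (K⁺ q a b) ≡ #Emb AF (K⁺ p* a* b*)
K⁺-balanced-copy AF p a b a≢b pa≡pb p* balanced a* b* a*≢b* pa*≡pb* =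
  q , q-balanced , qa≡pa , qb≡pb , trans (#Emb-K⁺-relabel AF p₂ a b τ ττ) (trans same₂ same₁)
  where
  σ₁ = transpose a a*
  σ₁σ₁ = transpose-involutive a a*
  b₁ = σ₁ b*
  σ₂ = transpose b b₁
  σ₂σ₂ = transpose-involutive b b₁
  p₂ = p* ∘ σ₁ ∘ σ₂
  a≢b₁ : a ≢ b₁
  a≢b₁ a≡b₁ = a*≢b* (trans (sym (transpose-matchˡ a a*)) (trans (cong σ₁ a≡b₁) (σ₁σ₁ b*)))
  σ₂a≡a : σ₂ a ≡ a
  σ₂a≡a = transpose-other b b₁ a a≢b a≢b₁
  same₁ : #Emb AF (K⁺ (p* ∘ σ₁) a b₁) ≡ #Emb AF (K⁺ p* a* b*)
  same₁ = trans (cong (λ x → #Emb AF (K⁺ (p* ∘ σ₁) x b₁)) (sym (transpose-matchʳ a a*)))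
                (#Emb-K⁺-permute σ₁ σ₁σ₁ AF p* a* b*)
  same₂ : #Emb AF (K⁺ p₂ a b) ≡ #Emb AF (K⁺ (p* ∘ σ₁) a b₁)
  same₂ = trans (cong₂ (λ x y → #Emb AF (K⁺ p₂ x y)) (sym σ₂a≡a) (sym (transpose-matchʳ b b₁)))
                (#Emb-K⁺-permute σ₂ σ₂σ₂ AF (p* ∘ σ₁) a b₁)
  p₂a≡p*a* : p₂ a ≡ p* a*
  p₂a≡p*a* = cong (p* ∘ σ₁) σ₂a≡a ⟨ trans ⟩ cong p* (transpose-matchˡ a a*)
  p₂b≡p*b* : p₂ b ≡ p* b*
  p₂b≡p*b* = cong (p* ∘ σ₁) (transpose-matchˡ b b₁) ⟨ trans ⟩ cong p* (σ₁σ₁ b*)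
  τ = transpose (p₂ a) (p a)
  ττ = transpose-involutive (p₂ a) (p a)
  q = τ ∘ p₂
  qa≡pa : q a ≡ p a
  qa≡pa = transpose-matchˡ (p₂ a) (p a)
  qb≡pb : q b ≡ p b
  qb≡pb = trans (cong τ (trans p₂b≡p*b* (trans (sym pa*≡pb*) (sym p₂a≡p*a*)))) (trans qa≡pa pa≡pb)
  size-q : ∀ k → size q k ≡ partSize p* (τ k)
  size-q k = trans (size-relabel p₂ τ ττ k)
                   (trans (size-permute (p* ∘ σ₁) σ₂ σ₂σ₂ (τ k))
                          (trans (size-permute p* σ₁ σ₁σ₁ (τ k)) (sym (partSize≡size p* (τ k)))))
  q-balanced : ∀ k l → size q k ≤ size q l + 1
  q-balanced k l = subst₂ (λ x y → x ≤ y + 1) (sym (size-q k)) (sym (size-q l)) (balanced (τ k) (τ l))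

#Emb-K⁺≈Turán : ∀ {f n r} (AF : Adj f) → ¬ Colorable AF r → (p : Fin n → Fin r) (a b : Fin n) → a ≢ b → p a ≡ p b →
  (p* : Fin n → Fin r) → Balanced p* → (a* b* : Fin n) → a* ≢ b* → p* a* ≡ p* b* →
  #Emb AF (K⁺ p a b) * n ^ 3 ≈[ r * suc (spread p) * (f ^ 3 * n ^ f) ] #Emb AF (K⁺ p* a* b*) * n ^ 3
#Emb-K⁺≈Turán {f} {n} AF ¬col p a b a≢b pa≡pb p* balanced a* b* a*≢b* pa*≡pb*
  with K⁺-balanced-copy AF p a b a≢b pa≡pb p* balanced a* b* a*≢b* pa*≡pb*
... | q , q-balanced , qa≡pa , qb≡pb , same =
  subst (λ e → _ ≈[ _ ] e * n ^ 3) same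
    (≈-weaken (*-monoˡ-≤ (f ^ 3 * n ^ f) (sizeDistance-bound p q q-balanced))
              (#Emb-K⁺-sizeDistance AF ¬col a b a≢b p q qa≡pa qb≡pb))

-- Class-edges and missing cross-edges

Pair : ℕ → Set
Pair n = Fin n × Fin n

_≟ᵖ_ : ∀ {n} (e e′ : Pair n) → Dec (e ≡ e′)
_≟ᵖ_ = Prodₚ.≡-dec _≟ᶠ_ _≟ᶠ_

sort : ∀ {n} → Fin n → Fin n → Pair n
sort u v with u <?ᶠ v
... | yes _ = u , v
... | no  _ = v , u

sort-cases : ∀ {n} (u v : Fin n) → sort u v ≡ (u , v) ⊎ sort u v ≡ (v , u)
sort-cases u v with u <?ᶠ v
... | yes _ = inj₁ refl
... | no  _ = inj₂ refl

sort-ordered : ∀ {n} (u v : Fin n) → u ≢ v → ltF (proj₁ (sort u v)) (proj₂ (sort u v)) ≡ true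
sort-ordered u v u≢v with u <?ᶠ v
... | yes u<v = isYes-true⁺ (u <?ᶠ v) u<v
... | no  u≮v = isYes-true⁺ (v <?ᶠ u) (Finₚ.≤∧≢⇒< (≮⇒≥ u≮v) (u≢v ∘ sym))

isPair-sort : ∀ {n} (u v : Fin n) → isPair (proj₁ (sort u v)) (proj₂ (sort u v)) u v ≡ true
isPair-sort u v with sort-cases u v
... | inj₁ eq rewrite eq = isPair⁺ˡ u v
... | inj₂ eq rewrite eq = isPair⁺ʳ v u

sorted-pair-unique : ∀ {n} {u v u′ v′ x y : Fin n} → u <ᶠ v → u′ <ᶠ v′ →
  isPair u v x y ≡ true → isPair u′ v′ x y ≡ true → (u , v) ≡ (u′ , v′)
sorted-pair-unique {u = u} {v} {u′} {v′} {x} {y} u<v u′<v′ xy≡uv xy≡u′v′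
  with isPair⁻ u v x y xy≡uv | isPair⁻ u′ v′ x y xy≡u′v′
... | inj₁ (refl , refl) | inj₁ (refl , refl) = refl
... | inj₁ (refl , refl) | inj₂ (refl , refl) = contradiction u′<v′ (Finₚ.<-asym u<v)
... | inj₂ (refl , refl) | inj₁ (refl , refl) = contradiction u′<v′ (Finₚ.<-asym u<v)
... | inj₂ (refl , refl) | inj₂ (refl , refl) = refl

vertex-outside : ∀ {n} {u v u′ v′ : Fin n} → u <ᶠ v → u′ <ᶠ v′ → (u , v) ≢ (u′ , v′) →
  ∃[ z ] (z ≡ u′ ⊎ z ≡ v′) × z ≢ u × z ≢ v
vertex-outside {u = u} {v} {u′} {v′} u<v u′<v′ uv≢u′v′ with u′ ≟ᶠ u | u′ ≟ᶠ v | v′ ≟ᶠ u | v′ ≟ᶠ v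
... | no u′≢u | no u′≢v | _        | _        = u′ , inj₁ refl , u′≢u , u′≢v
... | _       | _       | no v′≢u  | no v′≢v  = v′ , inj₂ refl , v′≢u , v′≢v
... | yes refl | _      | yes refl | _        = contradiction u′<v′ (Finₚ.<-irrefl refl)
... | yes refl | _      | no _     | yes refl = contradiction refl uv≢u′v′
... | no _     | yes refl | yes refl | _      = contradiction u′<v′ (Finₚ.<-asym u<v)
... | no _     | yes refl | no _   | yes refl = contradiction u′<v′ (Finₚ.<-irrefl refl)

module _ {n r : ℕ} (p : Fin n → Fin r) (G : Graph n) where

  isClassEdge : Pair n → Bool
  isClassEdge (u , v) = ltF u v ∧ eqF (p u) (p v) ∧ adj G u v

  isMissingCrossEdge : Pair n → Bool
  isMissingCrossEdge (u , v) = ltF u v ∧ not (eqF (p u) (p v)) ∧ not (adj G u v)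

  classEdges : List (Pair n)
  classEdges = filterᵇ isClassEdge (pairs n)

  missingCrossEdges : List (Pair n)
  missingCrossEdges = filterᵇ isMissingCrossEdge (pairs n)

  -- The predicates in Defs are pattern lambdas, which agree with ours only after splitting the pair.
  classEdgesAdded≡ : classEdgesAdded p G ≡ length classEdges
  classEdgesAdded≡ = cong length (filter-≐ (T? ∘ _) (T? ∘ isClassEdge) ((λ { {_ , _} → id }) , (λ { {_ , _} → id })) (pairs n))

  crossEdgesDeleted≡ : crossEdgesDeleted p G ≡ length missingCrossEdges
  crossEdgesDeleted≡ =
    cong length (filter-≐ (T? ∘ _) (T? ∘ isMissingCrossEdge) ((λ { {_ , _} → id }) , (λ { {_ , _} → id })) (pairs n))

  classEdges-unique : Unique classEdges
  classEdges-unique = Uniqueₚ.filter⁺ (T? ∘ isClassEdge) (Uniqueₚ.cartesianProduct⁺ (Uniqueₚ.allFin⁺ n) (Uniqueₚ.allFin⁺ n))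

  private
    ∈-filter-pairs⁻ : ∀ (P : Pair n → Bool) {e} → e ∈ filterᵇ P (pairs n) → P e ≡ true
    ∈-filter-pairs⁻ P e∈ = T⇒≡true (proj₂ (∈-filter⁻ (T? ∘ P) {xs = pairs n} e∈))

    ∈-filter-pairs⁺ : ∀ (P : Pair n → Bool) {e} → P e ≡ true → e ∈ filterᵇ P (pairs n)
    ∈-filter-pairs⁺ P {u , v} Pe = ∈-filter⁺ (T? ∘ P) (∈-pairs u v) (≡true⇒T Pe)

  ∈-classEdges⁻ : ∀ {u v} → (u , v) ∈ classEdges → u <ᶠ v × p u ≡ p v × adj G u v ≡ true
  ∈-classEdges⁻ {u} {v} uv∈ =
    isYes-true⁻ (u <?ᶠ v) (Boolₚ.∧-conicalˡ _ _ class) ,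
    isYes-true⁻ (p u ≟ᶠ p v) (Boolₚ.∧-conicalˡ _ _ (Boolₚ.∧-conicalʳ (ltF u v) _ class)) ,
    Boolₚ.∧-conicalʳ (eqF (p u) (p v)) _ (Boolₚ.∧-conicalʳ (ltF u v) _ class)
    where class = ∈-filter-pairs⁻ isClassEdge uv∈

  ∈-missingCrossEdges⁻ : ∀ {u v} → (u , v) ∈ missingCrossEdges → u <ᶠ v × p u ≢ p v × adj G u v ≡ false
  ∈-missingCrossEdges⁻ {u} {v} uv∈ =
    isYes-true⁻ (u <?ᶠ v) (Boolₚ.∧-conicalˡ _ _ missing) ,
    isYes-false⁻ (p u ≟ᶠ p v) (Boolₚ.not-injective (Boolₚ.∧-conicalˡ _ _ (Boolₚ.∧-conicalʳ (ltF u v) _ missing))) ,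
    Boolₚ.not-injective (Boolₚ.∧-conicalʳ (not (eqF (p u) (p v))) _ (Boolₚ.∧-conicalʳ (ltF u v) _ missing))
    where missing = ∈-filter-pairs⁻ isMissingCrossEdge uv∈

  ∈-classEdges⁺ : ∀ u v → u ≢ v → p u ≡ p v → adj G u v ≡ true → sort u v ∈ classEdges
  ∈-classEdges⁺ u v u≢v pu≡pv uv∈G with sort-cases u v | sort-ordered u v u≢v
  ... | inj₁ eq | ordered rewrite eq =
    ∈-filter-pairs⁺ isClassEdge (cong₂ _∧_ ordered (cong₂ _∧_ (isYes-true⁺ (p u ≟ᶠ p v) pu≡pv) uv∈G))
  ... | inj₂ eq | ordered rewrite eq =
    ∈-filter-pairs⁺ isClassEdge (cong₂ _∧_ ordered (cong₂ _∧_ (isYes-true⁺ (p v ≟ᶠ p u) (sym pu≡pv)) (trans (adj-sym G v u) uv∈G)))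

  ∈-missingCrossEdges⁺ : ∀ u v → u ≢ v → p u ≢ p v → adj G u v ≡ false → sort u v ∈ missingCrossEdges
  ∈-missingCrossEdges⁺ u v u≢v pu≢pv uv∉G with sort-cases u v | sort-ordered u v u≢v
  ... | inj₁ eq | ordered rewrite eq =
    ∈-filter-pairs⁺ isMissingCrossEdge (cong₂ _∧_ ordered (cong₂ _∧_ (cong not (isYes-false⁺ (p u ≟ᶠ p v) pu≢pv)) (cong not uv∉G)))
  ... | inj₂ eq | ordered rewrite eq =
    ∈-filter-pairs⁺ isMissingCrossEdge (cong₂ _∧_ ordered (cong₂ _∧_ (cong not (isYes-false⁺ (p v ≟ᶠ p u) (pu≢pv ∘ sym)))
                                                                      (cong not (trans (adj-sym G v u) uv∉G))))

covers : ∀ {f n} → Pair n → Vec (Fin n) f → Bool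
covers (u , v) φ = ⌊ u ∈ᵛ? φ ⌋ ∧ ⌊ v ∈ᵛ? φ ⌋

covers⁻ : ∀ {f n} (u v : Fin n) (φ : Vec (Fin n) f) → covers (u , v) φ ≡ true → u ∈ᵛ φ × v ∈ᵛ φ
covers⁻ u v φ cov = isYes-true⁻ (u ∈ᵛ? φ) (Boolₚ.∧-conicalˡ _ _ cov) , isYes-true⁻ (v ∈ᵛ? φ) (Boolₚ.∧-conicalʳ ⌊ u ∈ᵛ? φ ⌋ _ cov)

covers-sort : ∀ {f n} {u v : Fin n} (φ : Vec (Fin n) f) → u ∈ᵛ φ → v ∈ᵛ φ → covers (sort u v) φ ≡ true
covers-sort {u = u} {v} φ u∈φ v∈φ with sort-cases u v
... | inj₁ eq rewrite eq = cong₂ _∧_ (isYes-true⁺ (u ∈ᵛ? φ) u∈φ) (isYes-true⁺ (v ∈ᵛ? φ) v∈φ)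
... | inj₂ eq rewrite eq = cong₂ _∧_ (isYes-true⁺ (v ∈ᵛ? φ) v∈φ) (isYes-true⁺ (u ∈ᵛ? φ) u∈φ)

module _ {f n r : ℕ} (F : Graph f) (¬col : ¬ Colorable (adj F) r) (p : Fin n → Fin r) (G : Graph n) where

  private
    AF = adj F
    AG = adj G
    CE = classEdges p G
    DE = missingCrossEdges p G

  K⁺ₑ : Pair n → Adj n
  K⁺ₑ (u , v) = K⁺ p u v

  coversTwo : Pair n → Pair n → Vec (Fin n) f → Bool
  coversTwo e e′ φ = not ⌊ e ≟ᵖ e′ ⌋ ∧ covers e φ ∧ covers e′ φ

  embedsCovering : Pair n → Pair n → Vec (Fin n) f → Bool
  embedsCovering e d φ = isEmbedding AF (K⁺ₑ e) φ ∧ covers d φ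

  private
    edge-ends-differ : ∀ (φ : Vec (Fin n) f) → Injectiveᵛ φ → ∀ {i j} → AF i j ≡ true → lookup φ i ≢ lookup φ j
    edge-ends-differ φ inj {i} {j} ij∈F φi≡φj with inj i j φi≡φj
    ... | refl with () ← trans (sym ij∈F) (adj-irr F i)

  embedding-split : ∀ φ → 𝟙 (isEmbedding AF AG φ) ≤
    ∑ˡ CE (λ e → 𝟙 (isEmbedding AF (K⁺ₑ e) φ)) + ∑ˡ CE (λ e → ∑ˡ CE (λ e′ → 𝟙 (coversTwo e e′ φ)))
  embedding-split φ with isEmbedding AF AG φ in emb
  ... | false = z≤n
  ... | true with monochromatic-edge AF r ¬col (p ∘ lookup φ)
  ...   | i , j , ij∈F , same-part = one-of-two
    where
    inj = isEmbedding⇒injective AF AG φ emb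
    class-edge : ∀ {k l} → AF k l ≡ true → p (lookup φ k) ≡ p (lookup φ l) → sort (lookup φ k) (lookup φ l) ∈ CE
    class-edge {k} {l} kl∈F same = ∈-classEdges⁺ p G _ _ (edge-ends-differ φ inj kl∈F) same
                                     (isEmbedding⇒edge-preserving AF AG φ emb k l kl∈F)
    e = sort (lookup φ i) (lookup φ j)
    one-of-two : 1 ≤ ∑ˡ CE (λ e → 𝟙 (isEmbedding AF (K⁺ₑ e) φ)) + ∑ˡ CE (λ e → ∑ˡ CE (λ e′ → 𝟙 (coversTwo e e′ φ)))
    one-of-two with Finₚ.any? (λ k → Finₚ.any? (λ l → (AF k l Boolₚ.≟ true) ×-dec
                    ((p (lookup φ k) ≟ᶠ p (lookup φ l)) ×-dec (isPair (proj₁ e) (proj₂ e) (lookup φ k) (lookup φ l) Boolₚ.≟ false))))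
    ... | yes (k , l , kl∈F , same , off-e) =
      ≤-trans (≤-reflexive (cong 𝟙 (sym two)))
              (≤-trans (term≤∑ˡ (λ e′ → 𝟙 (coversTwo e e′ φ)) (class-edge kl∈F same))
                       (≤-trans (term≤∑ˡ (λ e → ∑ˡ CE (λ e′ → 𝟙 (coversTwo e e′ φ))) (class-edge ij∈F same-part)) (m≤n+m _ _)))
      where
      e′ = sort (lookup φ k) (lookup φ l)
      e≢e′ : e ≢ e′
      e≢e′ e≡e′ with () ← trans (sym (isPair-sort (lookup φ k) (lookup φ l)))
                              (trans (cong (λ x → isPair (proj₁ x) (proj₂ x) (lookup φ k) (lookup φ l)) (sym e≡e′)) off-e)
      two : coversTwo e e′ φ ≡ true
      two = cong₂ _∧_ (cong not (isYes-false⁺ (e ≟ᵖ e′) e≢e′))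
                      (cong₂ _∧_ (covers-sort φ (i , refl) (j , refl)) (covers-sort φ (k , refl) (l , refl)))
    ... | no none =
      ≤-trans (≤-reflexive (cong 𝟙 (sym embeds)))
              (≤-trans (term≤∑ˡ (λ e → 𝟙 (isEmbedding AF (K⁺ₑ e) φ)) (class-edge ij∈F same-part)) (m≤m+n _ _))
      where
      embeds : isEmbedding AF (K⁺ₑ e) φ ≡ true
      embeds = isEmbedding-intro AF (K⁺ₑ e) φ inj λ k l kl∈F → edge k l kl∈F
        where
        edge : ∀ k l → AF k l ≡ true → K⁺ₑ e (lookup φ k) (lookup φ l) ≡ true
        edge k l kl∈F with p (lookup φ k) ≟ᶠ p (lookup φ l)
        ... | no  _    = refl
        ... | yes same with isPair (proj₁ e) (proj₂ e) (lookup φ k) (lookup φ l) in on-e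
        ...   | true  = refl
        ...   | false = contradiction (k , l , kl∈F , same , on-e) none

  missing-edge-split : ∀ {e} → e ∈ CE → ∀ φ → 𝟙 (isEmbedding AF (K⁺ₑ e) φ) ≤
    𝟙 (isEmbedding AF (K⁺ₑ e) φ ∧ isEmbedding AF AG φ) + ∑ˡ DE (λ d → 𝟙 (embedsCovering e d φ))
  missing-edge-split {e} e∈CE φ with isEmbedding AF (K⁺ₑ e) φ in emb | isEmbedding AF AG φ in embG
  ... | false | _     = z≤n
  ... | true  | true  = m≤m+n 1 _
  ... | true  | false with Finₚ.any? (λ k → Finₚ.any? (λ l → (AF k l Boolₚ.≟ true) ×-dec (AG (lookup φ k) (lookup φ l) Boolₚ.≟ false)))
  ...   | no all-present = contradiction
          (isEmbedding-intro AF AG φ (isEmbedding⇒injective AF (K⁺ₑ e) φ emb)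
                             (λ k l kl∈F → ≢false⇒≡true (λ kl∉G → all-present (k , l , kl∈F , kl∉G))))
          (λ embG′ → contradiction (trans (sym embG′) embG) λ ())
  ...   | yes (k , l , kl∈F , kl∉G) =
    ≤-trans (≤-reflexive (cong 𝟙 (sym (covers-sort φ (k , refl) (l , refl))))) (term≤∑ˡ (λ d → 𝟙 (covers d φ)) d∈DE)
    where
    x = lookup φ k
    y = lookup φ l
    not-e : isPair (proj₁ e) (proj₂ e) x y ≡ false
    not-e = ≢true⇒≡false λ xy≡e → contradiction (trans (sym kl∉G) (e-in-G (isPair⁻ _ _ x y xy≡e))) λ ()
      where
      e∈G = proj₂ (proj₂ (∈-classEdges⁻ p G e∈CE))
      e-in-G : (x ≡ proj₁ e × y ≡ proj₂ e) ⊎ (x ≡ proj₂ e × y ≡ proj₁ e) → AG x y ≡ true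
      e-in-G (inj₁ (x≡u , y≡v)) = subst₂ (λ a b → AG a b ≡ true) (sym x≡u) (sym y≡v) e∈G
      e-in-G (inj₂ (x≡v , y≡u)) = subst₂ (λ a b → AG a b ≡ true) (sym x≡v) (sym y≡u) (trans (adj-sym G _ _) e∈G)
    cross : p x ≢ p y
    cross = isYes-false⁻ (p x ≟ᶠ p y) (Boolₚ.not-injective
      (trans (sym (Boolₚ.∨-identityʳ _)) (subst (λ b → not (eqF (p x) (p y)) ∨ b ≡ true) not-e
        (isEmbedding⇒edge-preserving AF (K⁺ₑ e) φ emb k l kl∈F))))
    d∈DE : sort x y ∈ DE
    d∈DE = ∈-missingCrossEdges⁺ p G x y (cross ∘ cong p) cross kl∉G

  at-most-one-K⁺ₑ : ∀ φ → ∑ˡ CE (λ e → 𝟙 (isEmbedding AF (K⁺ₑ e) φ)) ≤ 1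
  at-most-one-K⁺ₑ φ = ∑ˡ-≤1 CE (classEdges-unique p G) (λ e → 𝟙≤1 _) λ e e′ e∈CE e′∈CE emb emb′ →
    unique e e′ e∈CE e′∈CE (𝟙≡1⇒true emb) (𝟙≡1⇒true emb′)
    where
    unique : ∀ e e′ → e ∈ CE → e′ ∈ CE → isEmbedding AF (K⁺ₑ e) φ ≡ true → isEmbedding AF (K⁺ₑ e′) φ ≡ true → e ≡ e′
    unique e e′ e∈CE e′∈CE emb emb′ with embedding-uses-added-edge AF ¬col p (proj₁ e′) (proj₂ e′) φ emb′
    ... | i , j , ij∈F , ij↦e′ = sorted-pair-unique {x = lookup φ i} {lookup φ j}
                                   (proj₁ (∈-classEdges⁻ p G e∈CE)) (proj₁ (∈-classEdges⁻ p G e′∈CE)) ij↦e ij↦e′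
      where
      same-part : p (lookup φ i) ≡ p (lookup φ j)
      e′-in-part = proj₁ (proj₂ (∈-classEdges⁻ p G e′∈CE))
      same-part with isPair⁻ _ _ (lookup φ i) (lookup φ j) ij↦e′
      ... | inj₁ (φi≡u , φj≡v) = trans (cong p φi≡u) (trans e′-in-part (cong p (sym φj≡v)))
      ... | inj₂ (φi≡v , φj≡u) = trans (cong p φi≡v) (trans (sym e′-in-part) (cong p (sym φj≡u)))
      ij↦e : isPair (proj₁ e) (proj₂ e) (lookup φ i) (lookup φ j) ≡ true
      ij↦e = subst (λ b → not b ∨ isPair (proj₁ e) (proj₂ e) (lookup φ i) (lookup φ j) ≡ true)
                   (isYes-true⁺ (p (lookup φ i) ≟ᶠ p (lookup φ j)) same-part)
                   (isEmbedding⇒edge-preserving AF (K⁺ₑ e) φ emb i j ij∈F)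

  coversTwo-bound : ∀ {e e′} → e ∈ CE → e′ ∈ CE → count f (coversTwo e e′) * n ^ 3 ≤ f ^ 3 * n ^ f
  coversTwo-bound {e} {e′} e∈CE e′∈CE = by-cases (e ≟ᵖ e′)
    where
    by-cases : Dec (e ≡ e′) → count f (coversTwo e e′) * n ^ 3 ≤ f ^ 3 * n ^ f
    by-cases (yes refl) = 0*-≤ _ _ (count-none f (coversTwo e e) λ φ two →
      contradiction (trans (cong not (sym (isYes-true⁺ (e ≟ᵖ e) refl))) (Boolₚ.∧-conicalˡ _ _ two)) λ ())
    by-cases (no e≢e′) with vertex-outside (proj₁ (∈-classEdges⁻ p G e∈CE)) (proj₁ (∈-classEdges⁻ p G e′∈CE)) e≢e′
    ... | z , z∈e′ , z≢u , z≢v =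
      count-hits₃ f (coversTwo e e′) (proj₁ e) (proj₂ e) z (Finₚ.<⇒≢ (proj₁ (∈-classEdges⁻ p G e∈CE))) (z≢u ∘ sym) (z≢v ∘ sym) hits
      where
      hits : ∀ φ → coversTwo e e′ φ ≡ true → proj₁ e ∈ᵛ φ × proj₂ e ∈ᵛ φ × z ∈ᵛ φ
      hits φ two with covers⁻ (proj₁ e) (proj₂ e) φ (Boolₚ.∧-conicalˡ _ _ (Boolₚ.∧-conicalʳ (not ⌊ e ≟ᵖ e′ ⌋) _ two))
                    | covers⁻ (proj₁ e′) (proj₂ e′) φ (Boolₚ.∧-conicalʳ (covers e φ) _ (Boolₚ.∧-conicalʳ (not ⌊ e ≟ᵖ e′ ⌋) _ two))
      ... | u∈φ , v∈φ | u′∈φ , v′∈φ = u∈φ , v∈φ , [ (λ { refl → u′∈φ }) , (λ { refl → v′∈φ }) ] z∈e′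

  embedsCovering-bound : ∀ {e d} → e ∈ CE → d ∈ DE → count f (embedsCovering e d) * n ^ 3 ≤ f ^ 3 * n ^ f
  embedsCovering-bound {e} {d} e∈CE d∈DE
    with vertex-outside (proj₁ (∈-classEdges⁻ p G e∈CE)) (proj₁ (∈-missingCrossEdges⁻ p G d∈DE)) e≢d
    where
    e≢d : e ≢ d
    e≢d refl = proj₁ (proj₂ (∈-missingCrossEdges⁻ p G d∈DE)) (proj₁ (proj₂ (∈-classEdges⁻ p G e∈CE)))
  ... | z , z∈d , z≢u , z≢v =
    count-hits₃ f (embedsCovering e d) (proj₁ e) (proj₂ e) z (Finₚ.<⇒≢ (proj₁ (∈-classEdges⁻ p G e∈CE))) (z≢u ∘ sym) (z≢v ∘ sym) hits
    where
    hits : ∀ φ → embedsCovering e d φ ≡ true → proj₁ e ∈ᵛ φ × proj₂ e ∈ᵛ φ × z ∈ᵛ φ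
    hits φ cov with embedding-covers-added-edge AF ¬col p (proj₁ e) (proj₂ e) φ (Boolₚ.∧-conicalˡ _ _ cov)
                  | covers⁻ (proj₁ d) (proj₂ d) φ (Boolₚ.∧-conicalʳ (isEmbedding AF (K⁺ₑ e) φ) _ cov)
    ... | u∈φ , v∈φ | d₁∈φ , d₂∈φ = u∈φ , v∈φ , [ (λ { refl → d₁∈φ }) , (λ { refl → d₂∈φ }) ] z∈d

  #Emb≤∑ˡ-K⁺ₑ : #Emb AF AG * n ^ 3 ≤ ∑ˡ CE (λ e → #Emb AF (K⁺ₑ e) * n ^ 3) + length CE * (length CE * (f ^ 3 * n ^ f))
  #Emb≤∑ˡ-K⁺ₑ = begin
    #Emb AF AG * n ^ 3                                  ≤⟨ *-monoˡ-≤ (n ^ 3) (∑ᵛ-mono-≤ f embedding-split) ⟩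
    ∑ᵛ f (λ φ → in-K⁺ₑ φ + in-two φ) * n ^ 3            ≡⟨ ∑ᵛ-+-*ʳ f in-K⁺ₑ in-two (n ^ 3) ⟩
    ∑ᵛ f in-K⁺ₑ * n ^ 3 + ∑ᵛ f in-two * n ^ 3           ≤⟨ +-mono-≤ (≤-reflexive (∑ᵛ-∑ˡ-*ʳ f CE _ (n ^ 3)))
                                                             (∑ᵛ-∑ˡ²-bounded f CE CE _ (n ^ 3) _ coversTwo-bound) ⟩
    ∑ˡ CE (λ e → #Emb AF (K⁺ₑ e) * n ^ 3) + length CE * (length CE * (f ^ 3 * n ^ f)) ∎
    where
    open ≤-Reasoning
    in-K⁺ₑ in-two : Vec (Fin n) f → ℕ
    in-K⁺ₑ φ = ∑ˡ CE (λ e → 𝟙 (isEmbedding AF (K⁺ₑ e) φ))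
    in-two φ = ∑ˡ CE (λ e → ∑ˡ CE (λ e′ → 𝟙 (coversTwo e e′ φ)))

  ∑ˡ-K⁺ₑ≤#Emb : ∑ˡ CE (λ e → #Emb AF (K⁺ₑ e) * n ^ 3) ≤ #Emb AF AG * n ^ 3 + length CE * (length DE * (f ^ 3 * n ^ f))
  ∑ˡ-K⁺ₑ≤#Emb = begin
    ∑ˡ CE (λ e → #Emb AF (K⁺ₑ e) * n ^ 3)               ≡⟨ ∑ᵛ-∑ˡ-*ʳ f CE _ (n ^ 3) ⟨
    ∑ᵛ f in-K⁺ₑ * n ^ 3                                 ≤⟨ *-monoˡ-≤ (n ^ 3) (∑ᵛ-mono-≤ f split) ⟩
    ∑ᵛ f (λ φ → in-G φ + in-covering φ) * n ^ 3         ≡⟨ ∑ᵛ-+-*ʳ f in-G in-covering (n ^ 3) ⟩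
    ∑ᵛ f in-G * n ^ 3 + ∑ᵛ f in-covering * n ^ 3        ≤⟨ +-monoʳ-≤ _ (∑ᵛ-∑ˡ²-bounded f CE DE _ (n ^ 3) _ embedsCovering-bound) ⟩
    #Emb AF AG * n ^ 3 + length CE * (length DE * (f ^ 3 * n ^ f)) ∎
    where
    open ≤-Reasoning
    in-K⁺ₑ in-G in-covering : Vec (Fin n) f → ℕ
    in-K⁺ₑ φ = ∑ˡ CE (λ e → 𝟙 (isEmbedding AF (K⁺ₑ e) φ))
    in-G φ = 𝟙 (isEmbedding AF AG φ)
    in-covering φ = ∑ˡ CE (λ e → ∑ˡ DE (λ d → 𝟙 (embedsCovering e d φ)))
    in-K⁺ₑ∧G≤in-G : ∀ φ → ∑ˡ CE (λ e → 𝟙 (isEmbedding AF (K⁺ₑ e) φ ∧ isEmbedding AF AG φ)) ≤ in-G φ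
    in-K⁺ₑ∧G≤in-G φ with isEmbedding AF AG φ
    ... | true  = ≤-trans (≤-reflexive (∑ˡ-cong CE (λ e _ → cong 𝟙 (Boolₚ.∧-identityʳ _)))) (at-most-one-K⁺ₑ φ)
    ... | false = ≤-trans (∑ˡ-bounded CE 0 (λ e _ → ≤-reflexive (cong 𝟙 (Boolₚ.∧-zeroʳ _)))) (≤-reflexive (*-zeroʳ (length CE)))
    split : ∀ φ → in-K⁺ₑ φ ≤ in-G φ + in-covering φ
    split φ = begin
      in-K⁺ₑ φ                                                                      ≤⟨ ∑ˡ-mono-≤ CE (λ e e∈CE → missing-edge-split e∈CE φ) ⟩
      ∑ˡ CE (λ e → 𝟙 (isEmbedding AF (K⁺ₑ e) φ ∧ isEmbedding AF AG φ) + ∑ˡ DE (λ d → 𝟙 (embedsCovering e d φ)))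
                                                                                    ≡⟨ ∑ˡ-distrib-+ CE _ _ ⟩
      ∑ˡ CE (λ e → 𝟙 (isEmbedding AF (K⁺ₑ e) φ ∧ isEmbedding AF AG φ)) + in-covering φ ≤⟨ +-monoˡ-≤ _ (in-K⁺ₑ∧G≤in-G φ) ⟩
      in-G φ + in-covering φ                                                        ∎

#Emb≈classEdges*Turán : ∀ {f n r} (F : Graph f) → ¬ Colorable (adj F) r → (p : Fin n → Fin r) (G : Graph n) →
  (p* : Fin n → Fin r) → Balanced p* → (a* b* : Fin n) → a* ≢ b* → p* a* ≡ p* b* →
  classEdgesAdded p G * (#Emb (adj F) (K⁺ p* a* b*) * n ^ 3)
    ≈[ classEdgesAdded p G * ((r * suc (spread p) + (classEdgesAdded p G + crossEdgesDeleted p G)) * (f ^ 3 * n ^ f)) ]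
  #Emb (adj F) (adj G) * n ^ 3
#Emb≈classEdges*Turán {f} {n} {r} F ¬col p G p* balanced a* b* a*≢b* pa*≡pb*
  rewrite classEdgesAdded≡ p G | crossEdgesDeleted≡ p G =
  subst (λ e → length CE * (#Emb (adj F) (K⁺ p* a* b*) * n ^ 3) ≈[ e ] #Emb (adj F) (adj G) * n ^ 3)
        (error-terms (length CE) (length DE))
    (≈-trans (≈-sym (∑ˡ-≈ CE each-≈-Turán))
             (≤-trans (∑ˡ-K⁺ₑ≤#Emb F ¬col p G) (+-monoʳ-≤ _ (*-monoʳ-≤ (length CE) (*-monoˡ-≤ M (m≤n+m (length DE) (length CE))))) ,
              ≤-trans (#Emb≤∑ˡ-K⁺ₑ F ¬col p G) (+-monoʳ-≤ _ (*-monoʳ-≤ (length CE) (*-monoˡ-≤ M (m≤m+n (length CE) (length DE)))))))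
  where
  CE = classEdges p G
  DE = missingCrossEdges p G
  M = f ^ 3 * n ^ f
  each-≈-Turán : ∀ e → e ∈ CE → #Emb (adj F) (K⁺ₑ F ¬col p G e) * n ^ 3 ≈[ r * suc (spread p) * M ] #Emb (adj F) (K⁺ p* a* b*) * n ^ 3
  each-≈-Turán (u , v) e∈CE with ∈-classEdges⁻ p G e∈CE
  ... | u<v , pu≡pv , _ = #Emb-K⁺≈Turán (adj F) ¬col p u v (Finₚ.<⇒≢ u<v) pu≡pv p* balanced a* b* a*≢b* pa*≡pb*
  error-terms : ∀ a₁ a₂ → a₁ * (r * suc (spread p) * M) + a₁ * ((a₁ + a₂) * M) ≡ a₁ * ((r * suc (spread p) + (a₁ + a₂)) * M)
  error-terms a₁ a₂ = solve 5 (λ a₁ a₂ R m s → a₁ :* (R :* s :* m) :+ a₁ :* ((a₁ :+ a₂) :* m) := a₁ :* ((R :* s :+ (a₁ :+ a₂)) :* m))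
                              refl a₁ a₂ r M (suc (spread p))

-- The case α₁ = 0 is separate because only α₁ ≥ 1 makes φ ≥ 2, which pays for the 1 in s + 1.
error-term≤ : ∀ f³ r α₁ α₂ s nᶠ →
  α₁ * ((r * suc s + (α₁ + α₂)) * (f³ * nᶠ)) ≤ f³ * (1 + 2 * r) * α₁ * ((2 * (α₁ + α₂)) ⊔ s) * nᶠ
error-term≤ f³ r zero      α₂ s nᶠ = z≤n
error-term≤ f³ r α₁@(suc _) α₂ s nᶠ = begin
  α₁ * ((r * suc s + (α₁ + α₂)) * (f³ * nᶠ))  ≤⟨ *-monoʳ-≤ α₁ (*-monoˡ-≤ (f³ * nᶠ) (+-mono-≤ (*-monoʳ-≤ r suc-s≤2φ) α≤φ)) ⟩
  α₁ * ((r * (φ + φ) + φ) * (f³ * nᶠ))        ≡⟨ solve 5 (λ a R P F N → a :* ((R :* (P :+ P) :+ P) :* (F :* N))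
                                                             := F :* (con 1 :+ con 2 :* R) :* a :* P :* N) refl α₁ r φ f³ nᶠ ⟩
  f³ * (1 + 2 * r) * α₁ * φ * nᶠ              ∎
  where
  open ≤-Reasoning
  φ = (2 * (α₁ + α₂)) ⊔ s
  α≤φ : α₁ + α₂ ≤ φ
  α≤φ = ≤-trans (m≤m+n (α₁ + α₂) _) (m≤m⊔n _ s)
  suc-s≤2φ : suc s ≤ φ + φ
  suc-s≤2φ = +-mono-≤ (≤-trans (s≤s z≤n) α≤φ) (m≤n⊔m _ s)

copies≈classEdges*c : ∀ {f n r} (F : Graph f) → ¬ Colorable (adj F) r → (p : Fin n → Fin r) (G : Graph n) (c : ℕ) →
  TuranPlusEdgeValue F n r c →
  let α₁ = classEdgesAdded p G ; α₂ = crossEdgesDeleted p G in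
  α₁ * c * n ^ 3 ≈[ f ^ 3 * (1 + 2 * r) * α₁ * ((2 * (α₁ + α₂)) ⊔ spread p) * n ^ f ] copies F (adj G) * n ^ 3
copies≈classEdges*c {f} {n} {r} F ¬col p G c (p* , balanced , a* , b* , a*≢b* , pa*≡pb* , copies≡c)
  with #Aut (adj F) | 1≤#Aut (adj F) | copies*#Aut≡#Emb F (adj G) | copies*#Aut≡#Emb F (K⁺ p* a* b*)
... | suc k | _ | G-count | Turán-count = ≈-cancelˡ k
  (subst₂ (λ x y → x ≈[ α₁ * ((r * suc (spread p) + (α₁ + α₂)) * (f ^ 3 * n ^ f)) ] y) Turán-side G-side
          (#Emb≈classEdges*Turán F ¬col p G p* balanced a* b* a*≢b* pa*≡pb*))
  (≤-trans (error-term≤ (f ^ 3) r α₁ α₂ (spread p) (n ^ f)) (m≤n*m _ (suc k)))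
  where
  α₁ = classEdgesAdded p G
  α₂ = crossEdgesDeleted p G
  Turán-side : α₁ * (#Emb (adj F) (K⁺ p* a* b*) * n ^ 3) ≡ suc k * (α₁ * c * n ^ 3)
  Turán-side = trans (cong (λ e → α₁ * (e * n ^ 3)) (trans (sym Turán-count) (cong (_* suc k) copies≡c)))
                     (solve 4 (λ a C A N → a :* (C :* A :* N) := A :* (a :* C :* N)) refl α₁ c (suc k) (n ^ 3))
  G-side : #Emb (adj F) (adj G) * n ^ 3 ≡ suc k * (copies F (adj G) * n ^ 3)
  G-side = trans (cong (_* n ^ 3) (sym G-count)) (*-CS.xy∙z≈y∙xz (copies F (adj G)) (suc k) (n ^ 3))

lemma2p5 : ∀ {f} (F : Graph f) (r : ℕ) → ColorCritical F → ChromaticNumber (adj F) (suc r) →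
  Σ ℕ λ γ → 0 < γ × Σ ℕ λ n₀ → ∀ n → n₀ ≤ n →
    ∀ (c α₁ α₂ : ℕ) (p : Fin n → Fin r) (G : Graph n) →
    (∀ i → 1 ≤ partSize p i) →
    IsCnF F n r c →
    classEdgesAdded p G ≡ α₁ → crossEdgesDeleted p G ≡ α₂ →
    (α₁ * c * n ^ 3 ≤ copies F (adj G) * n ^ 3 + γ * α₁ * ((2 * (α₁ + α₂)) ⊔ spread p) * n ^ f) ×
    (copies F (adj G) * n ^ 3 ≤ α₁ * c * n ^ 3 + γ * α₁ * ((2 * (α₁ + α₂)) ⊔ spread p) * n ^ f)
lemma2p5 {zero}  F r (() , _) _
lemma2p5 {suc f} F r _ χ≡r+1 = suc f ^ 3 * (1 + 2 * r) , *-mono-≤ (m^n>0 (suc f) 3) (s≤s z≤n) , 0 ,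
  λ { n _ c _ _ p G _ (Turán+edge , _) refl refl → copies≈classEdges*c F (proj₂ χ≡r+1 r ≤-refl) p G c Turán+edge }
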